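{- The category of idempotent semifields (with semiring homomorphisms) is equivalent to the category of perfect MV-algebras (with MV-algebra homomorphisms).
   Context: An MV-algebra is a structure $(A,\oplus,\neg,0)$ where $(A,\oplus,0)$ is a commutative monoid, $\neg\neg x=x$, $x\oplus \neg 0=\neg 0$, and $\neg(\neg x\oplus y)\oplus y=\neg(\neg y\oplus x)\oplus x$; put $1=\neg 0$, $x\odot y=\neg(\neg x\oplus\neg y)$, and order $A$ by $x\le y$ iff $y=x\oplus z$ for some $z$. An element $x$ is infinitesimal if $nx\le \neg x$ for every positive integer $n$ (where $nx=x\oplus\cdots\oplus x$); the radical $Rad(A)$ is the set of infinitesimals. $A$ is perfect if it is generated by $Rad(A)$, equivalently $A=Rad(A)\cup\{\neg x: x\in Rad(A)\}$. A semifield is a semiring $(F,+,\times,0,1)$ (commutative monoid $(F,+,0)$, monoid $(F,\times,1)$, distributive laws, $0\cdot a=a\cdot 0=0$) with commutative multiplication in which every nonzero element has a multiplicative inverse; it is idempotent if $x+x=x$ for all $x$. -}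

module Defs where

open import Level using (Level; _⊔_) renaming (suc to lsuc)
open import Data.Nat using (ℕ; zero; suc)
open import Data.Product using (Σ; ∃; _×_; _,_; proj₁; proj₂)
open import Data.Sum using (_⊎_)
open import Data.Empty using (⊥)
open import Function.Base using (id; _∘_)
open import Relation.Binary.Core using (Rel)
open import Relation.Binary.Structures using (IsEquivalence)
open import Algebra.Core using (Op₁; Op₂)
open import Algebra.Structures using (IsCommutativeMonoid)
open import Algebra.Bundles using (CommutativeSemiring)
open import Algebra.Morphism.Structures using (module SemiringMorphisms)
import Algebra.Morphism.Construct.Identity as HomId
import Algebra.Morphism.Construct.Composition as HomComp

record Category (o m e : Level) : Set (lsuc (o ⊔ m ⊔ e)) where
  infix  4 _≈_
  infixr 9 _∘ᶜ_
  field
    Obj      : Set o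
    Hom      : Obj → Obj → Set m
    _≈_      : ∀ {A B} → Rel (Hom A B) e
    idᶜ      : ∀ {A} → Hom A A
    _∘ᶜ_     : ∀ {A B C} → Hom B C → Hom A B → Hom A C
    ≈-equiv  : ∀ {A B} → IsEquivalence (_≈_ {A} {B})
    ∘-resp-≈ : ∀ {A B C} {f h : Hom B C} {g i : Hom A B} →
               f ≈ h → g ≈ i → (f ∘ᶜ g) ≈ (h ∘ᶜ i)
    assoc    : ∀ {A B C D} {f : Hom A B} {g : Hom B C} {h : Hom C D} →
               ((h ∘ᶜ g) ∘ᶜ f) ≈ (h ∘ᶜ (g ∘ᶜ f))
    identityˡ : ∀ {A B} {f : Hom A B} → (idᶜ ∘ᶜ f) ≈ f
    identityʳ : ∀ {A B} {f : Hom A B} → (f ∘ᶜ idᶜ) ≈ f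

record Functor {o m e o' m' e' : Level}
               (C : Category o m e) (D : Category o' m' e')
               : Set (o ⊔ m ⊔ e ⊔ o' ⊔ m' ⊔ e') where
  private
    module C = Category C
    module D = Category D
  field
    F₀       : C.Obj → D.Obj
    F₁       : ∀ {A B} → C.Hom A B → D.Hom (F₀ A) (F₀ B)
    identity : ∀ {A} → F₁ (C.idᶜ {A}) D.≈ D.idᶜ
    homomorphism : ∀ {A B X} {f : C.Hom A B} {g : C.Hom B X} →
                   F₁ (g C.∘ᶜ f) D.≈ (F₁ g D.∘ᶜ F₁ f)
    F-resp-≈ : ∀ {A B} {f g : C.Hom A B} → f C.≈ g → F₁ f D.≈ F₁ g

idF : ∀ {o m e} (C : Category o m e) → Functor C C
idF C = record
  { F₀ = id ; F₁ = id
  ; identity = IsEquivalence.refl ≈-equiv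
  ; homomorphism = IsEquivalence.refl ≈-equiv
  ; F-resp-≈ = id }
  where open Category C

_∘F_ : ∀ {o₁ m₁ e₁ o₂ m₂ e₂ o₃ m₃ e₃}
         {C : Category o₁ m₁ e₁} {D : Category o₂ m₂ e₂} {E : Category o₃ m₃ e₃} →
       Functor D E → Functor C D → Functor C E
_∘F_ {E = E} G F = record
  { F₀ = G.F₀ ∘ F.F₀
  ; F₁ = G.F₁ ∘ F.F₁
  ; identity = IsEquivalence.trans E.≈-equiv (G.F-resp-≈ F.identity) G.identity
  ; homomorphism = IsEquivalence.trans E.≈-equiv (G.F-resp-≈ F.homomorphism) G.homomorphism
  ; F-resp-≈ = G.F-resp-≈ ∘ F.F-resp-≈ }
  where
    module F = Functor F
    module G = Functor G
    module E = Category E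

record NaturalIsomorphism {o m e o' m' e' : Level}
         {C : Category o m e} {D : Category o' m' e'}
         (F G : Functor C D) : Set (o ⊔ m ⊔ e ⊔ o' ⊔ m' ⊔ e') where
  private
    module C = Category C
    module D = Category D
    module F = Functor F
    module G = Functor G
  field
    η        : ∀ A → D.Hom (F.F₀ A) (G.F₀ A)
    η⁻¹      : ∀ A → D.Hom (G.F₀ A) (F.F₀ A)
    isoˡ     : ∀ A → (η⁻¹ A D.∘ᶜ η A) D.≈ D.idᶜ
    isoʳ     : ∀ A → (η A D.∘ᶜ η⁻¹ A) D.≈ D.idᶜ
    commute  : ∀ {A B} (f : C.Hom A B) → (η B D.∘ᶜ F.F₁ f) D.≈ (G.F₁ f D.∘ᶜ η A)

record Equivalence {o m e o' m' e' : Level}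
         (C : Category o m e) (D : Category o' m' e')
         : Set (o ⊔ m ⊔ e ⊔ o' ⊔ m' ⊔ e') where
  field
    F    : Functor C D
    G    : Functor D C
    unit   : NaturalIsomorphism (idF C) (G ∘F F)
    counit : NaturalIsomorphism (F ∘F G) (idF D)

record IdempotentSemifield (c ℓ : Level) : Set (lsuc (c ⊔ ℓ)) where
  field
    commutativeSemiring : CommutativeSemiring c ℓ
  open CommutativeSemiring commutativeSemiring public
  field
    +-idem  : ∀ x → (x + x) ≈ x
    inverse : ∀ x → (x ≈ 0# → ⊥) → ∃ λ y → (x * y) ≈ 1#

SemiringHom : ∀ {c ℓ} → IdempotentSemifield c ℓ → IdempotentSemifield c ℓ → Set (c ⊔ ℓ)
SemiringHom S T =
  Σ (S.Carrier → T.Carrier) λ f → SemiringMorphisms.IsSemiringHomomorphism S.rawSemiring T.rawSemiring f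
  where
    module S = IdempotentSemifield S
    module T = IdempotentSemifield T

IdemSemifieldCat : ∀ c ℓ → Category (lsuc (c ⊔ ℓ)) (c ⊔ ℓ) (c ⊔ ℓ)
IdemSemifieldCat c ℓ = record
  { Obj = IdempotentSemifield c ℓ
  ; Hom = SemiringHom
  ; _≈_ = λ {A} {B} f g → ∀ x → IdempotentSemifield._≈_ B (proj₁ f x) (proj₁ g x)
  ; idᶜ = λ {A} → id , HomId.isSemiringHomomorphism (IdempotentSemifield.rawSemiring A) (IdempotentSemifield.refl A)
  ; _∘ᶜ_ = λ {A} {B} {C} g f → (proj₁ g ∘ proj₁ f) ,
             HomComp.isSemiringHomomorphism (IdempotentSemifield.trans C) (proj₂ f) (proj₂ g)
  ; ≈-equiv = λ {A} {B} → record
      { refl = λ x → IdempotentSemifield.refl B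
      ; sym = λ p x → IdempotentSemifield.sym B (p x)
      ; trans = λ p q x → IdempotentSemifield.trans B (p x) (q x) }
  ; ∘-resp-≈ = λ {A} {B} {C} {f} {h} {g} {i} p q x →
      IdempotentSemifield.trans C
        (SemiringMorphisms.IsSemiringHomomorphism.⟦⟧-cong (proj₂ f) (q x)) (p (proj₁ i x))
  ; assoc = λ {A} {B} {C} {D} x → IdempotentSemifield.refl D
  ; identityˡ = λ {A} {B} x → IdempotentSemifield.refl B
  ; identityʳ = λ {A} {B} x → IdempotentSemifield.refl B
  }

record MVAlgebra (c ℓ : Level) : Set (lsuc (c ⊔ ℓ)) where
  infix  4 _≈_
  infixl 6 _⊕_
  infix  8 ¬_
  infix  4 _≤_
  infixr 7 _·_
  field
    Carrier : Set c
    _≈_     : Rel Carrier ℓ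
    _⊕_     : Op₂ Carrier
    ¬_      : Op₁ Carrier
    𝟘       : Carrier
    isCommutativeMonoid : IsCommutativeMonoid _≈_ _⊕_ 𝟘
    ¬-cong  : ∀ {x y} → x ≈ y → ¬ x ≈ ¬ y
    ¬¬      : ∀ x → ¬ ¬ x ≈ x
    ⊕-absorb : ∀ x → x ⊕ ¬ 𝟘 ≈ ¬ 𝟘
    łukasiewicz : ∀ x y → ¬ (¬ x ⊕ y) ⊕ y ≈ ¬ (¬ y ⊕ x) ⊕ x
  open IsCommutativeMonoid isCommutativeMonoid public

  𝟙 : Carrier
  𝟙 = ¬ 𝟘

  _⊙_ : Op₂ Carrier
  x ⊙ y = ¬ (¬ x ⊕ ¬ y)

  _≤_ : Rel Carrier (c ⊔ ℓ)
  x ≤ y = ∃ λ z → y ≈ x ⊕ z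

  _·_ : ℕ → Carrier → Carrier
  zero  · x = 𝟘
  suc n · x = x ⊕ (n · x)

  Infinitesimal : Carrier → Set (c ⊔ ℓ)
  Infinitesimal x = ∀ n → (suc n · x) ≤ ¬ x

  Perfect : Set (c ⊔ ℓ)
  Perfect = ∀ x → Infinitesimal x ⊎ (∃ λ y → Infinitesimal y × x ≈ ¬ y)

record MVHom {c ℓ : Level} (A B : MVAlgebra c ℓ) : Set (c ⊔ ℓ) where
  private
    module A = MVAlgebra A
    module B = MVAlgebra B
  field
    ⟦_⟧    : A.Carrier → B.Carrier
    cong   : ∀ {x y} → x A.≈ y → ⟦ x ⟧ B.≈ ⟦ y ⟧
    ⊕-homo : ∀ x y → ⟦ x A.⊕ y ⟧ B.≈ ⟦ x ⟧ B.⊕ ⟦ y ⟧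
    ¬-homo : ∀ x → ⟦ A.¬ x ⟧ B.≈ B.¬ ⟦ x ⟧
    𝟘-homo : ⟦ A.𝟘 ⟧ B.≈ B.𝟘

record PerfectMVAlgebra (c ℓ : Level) : Set (lsuc (c ⊔ ℓ)) where
  field
    mvAlgebra : MVAlgebra c ℓ
    perfect   : MVAlgebra.Perfect mvAlgebra

PerfectMVCat : ∀ c ℓ → Category (lsuc (c ⊔ ℓ)) (c ⊔ ℓ) (c ⊔ ℓ)
PerfectMVCat c ℓ = record
  { Obj = PerfectMVAlgebra c ℓ
  ; Hom = λ A B → MVHom (mv A) (mv B)
  ; _≈_ = λ {A} {B} f g → ∀ x → MVAlgebra._≈_ (mv B) (MVHom.⟦_⟧ f x) (MVHom.⟦_⟧ g x)
  ; idᶜ = λ {A} → record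
      { ⟦_⟧ = id ; cong = id
      ; ⊕-homo = λ x y → MVAlgebra.refl (mv A)
      ; ¬-homo = λ x → MVAlgebra.refl (mv A)
      ; 𝟘-homo = MVAlgebra.refl (mv A) }
  ; _∘ᶜ_ = λ {A} {B} {C} g f → record
      { ⟦_⟧ = MVHom.⟦_⟧ g ∘ MVHom.⟦_⟧ f
      ; cong = MVHom.cong g ∘ MVHom.cong f
      ; ⊕-homo = λ x y → MVAlgebra.trans (mv C) (MVHom.cong g (MVHom.⊕-homo f x y)) (MVHom.⊕-homo g _ _)
      ; ¬-homo = λ x → MVAlgebra.trans (mv C) (MVHom.cong g (MVHom.¬-homo f x)) (MVHom.¬-homo g _)
      ; 𝟘-homo = MVAlgebra.trans (mv C) (MVHom.cong g (MVHom.𝟘-homo f)) (MVHom.𝟘-homo g) }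
  ; ≈-equiv = λ {A} {B} → record
      { refl = λ x → MVAlgebra.refl (mv B)
      ; sym = λ p x → MVAlgebra.sym (mv B) (p x)
      ; trans = λ p q x → MVAlgebra.trans (mv B) (p x) (q x) }
  ; ∘-resp-≈ = λ {A} {B} {C} {f} {h} {g} {i} p q x →
      MVAlgebra.trans (mv C) (MVHom.cong f (q x)) (p (MVHom.⟦_⟧ i x))
  ; assoc = λ {A} {B} {C} {D} x → MVAlgebra.refl (mv D)
  ; identityˡ = λ {A} {B} x → MVAlgebra.refl (mv B)
  ; identityʳ = λ {A} {B} x → MVAlgebra.refl (mv B)
  }
  where mv = PerfectMVAlgebra.mvAlgebra

{-# OPTIONS --safe #-}

-- Away from 0, an idempotent semifield F is a lattice-ordered abelian group (x ≤ y iff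
-- x + y ≈ y; join +, group operation ×), and a perfect MV-algebra is Γ(ℤ ×lex G, (1, 0))
-- for the lattice-ordered group G generated by its radical.  So F gives the perfect
-- MV-algebra whose infinitesimals are the elements ≥ 1 of F, the remaining elements being
-- their negations, with ⊕ computed by multiplication and division in F.  Conversely a
-- perfect MV-algebra A gives the semifield of formal differences a − b of infinitesimals
-- together with a zero, with + the join and × the addition of differences.  Perfection is
-- what makes the radical closed under ⊕, cancellative, and ⊕ distributive over ∨ on it,
-- so that the differences form a lattice-ordered group.  Excluded middle decides x ≈ 0,
-- which makes inversion total and splits F into 0 and the invertible elements.
module Submission where

open import Level using (_⊔_; Lift; lift)
open import Data.Bool using (Bool; true; false; not)
open import Data.Empty using (⊥; ⊥-elim)
open import Data.Maybe using (Maybe; just; nothing)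
import Data.Maybe as Maybe
open import Data.Nat using (zero; suc)
open import Data.Product using (∃; _×_; _,_; proj₁; proj₂)
open import Data.Sum using (_⊎_; inj₁; inj₂)
import Data.Sum as Sum
open import Data.Unit.Polymorphic using (⊤; tt)
import Data.Fin as Fin
open import Data.Vec using ([]; _∷_)
open import Relation.Nullary.Decidable using (yes; no)
open import Function.Base using (id; _∘_)
import Relation.Binary.PropositionalEquality as ≡
open ≡ using (_≡_)
open import Algebra.Bundles using (CommutativeMonoid; CommutativeSemiring)
open import Algebra.Structures.Biased using (isCommutativeSemiringˡ)
open import Relation.Binary.Structures using (IsEquivalence)
import Algebra.Properties.CommutativeSemigroup as CommutativeSemigroupProperties
import Algebra.Solver.CommutativeMonoid as CommutativeMonoidSolver
open import Axiom.ExcludedMiddle using (ExcludedMiddle)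
open import Algebra.Morphism.Structures using (module SemiringMorphisms)
open import Defs

module MVAlgebraProperties {c ℓ} (A : MVAlgebra c ℓ) where
  open MVAlgebra A public

  infixr 3 _⟫_
  _⟫_ : ∀ {x y z} → x ≈ y → y ≈ z → x ≈ z
  _⟫_ = trans

  ⊕-commutativeMonoid : CommutativeMonoid c ℓ
  ⊕-commutativeMonoid = record { isCommutativeMonoid = isCommutativeMonoid }

  open CommutativeSemigroupProperties (CommutativeMonoid.commutativeSemigroup ⊕-commutativeMonoid) public
    using (interchange; xy∙z≈xz∙y; x∙yz≈y∙xz)

  module ⊕-Solver = CommutativeMonoidSolver ⊕-commutativeMonoid

  infixl 6 _⊖_
  _⊖_ : Carrier → Carrier → Carrier
  x ⊖ y = ¬ (¬ x ⊕ y)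

  infixl 5 _∨_
  _∨_ : Carrier → Carrier → Carrier
  x ∨ y = (x ⊖ y) ⊕ y

  ⊖-cong : ∀ {x x' y y'} → x ≈ x' → y ≈ y' → x ⊖ y ≈ x' ⊖ y'
  ⊖-cong p q = ¬-cong (∙-cong (¬-cong p) q)

  ∨-cong : ∀ {x x' y y'} → x ≈ x' → y ≈ y' → x ∨ y ≈ x' ∨ y'
  ∨-cong p q = ∙-cong (⊖-cong p q) q

  ∨-comm : ∀ x y → x ∨ y ≈ y ∨ x
  ∨-comm = łukasiewicz

  ¬𝟙≈𝟘 : ¬ 𝟙 ≈ 𝟘
  ¬𝟙≈𝟘 = ¬¬ 𝟘

  ¬-injective : ∀ {x y} → ¬ x ≈ ¬ y → x ≈ y
  ¬-injective {x} {y} p = sym (¬¬ x) ⟫ ¬-cong p ⟫ ¬¬ y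

  ⊕-absorbˡ : ∀ x → 𝟙 ⊕ x ≈ 𝟙
  ⊕-absorbˡ x = comm 𝟙 x ⟫ ⊕-absorb x

  ⊕-complementˡ : ∀ x → ¬ x ⊕ x ≈ 𝟙
  ⊕-complementˡ x =
    ∙-congʳ (¬-cong (sym (∙-congʳ ¬𝟙≈𝟘 ⟫ identityˡ x))) ⟫ sym (łukasiewicz x 𝟙) ⟫ ⊕-absorb _

  ⊕-complementʳ : ∀ x → x ⊕ ¬ x ≈ 𝟙
  ⊕-complementʳ x = comm x (¬ x) ⟫ ⊕-complementˡ x

  ≤⇒¬⊕≈𝟙 : ∀ {x y} → x ≤ y → ¬ x ⊕ y ≈ 𝟙
  ≤⇒¬⊕≈𝟙 {x} {y} (z , p) = ∙-congˡ p ⟫ sym (assoc (¬ x) x z) ⟫ ∙-congʳ (⊕-complementˡ x) ⟫ ⊕-absorbˡ z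

  ¬⊕≈𝟙⇒≈∨ : ∀ {x y} → ¬ x ⊕ y ≈ 𝟙 → y ≈ y ∨ x
  ¬⊕≈𝟙⇒≈∨ {x} {y} p = sym (identityˡ y) ⟫ ∙-congʳ (sym ¬𝟙≈𝟘 ⟫ ¬-cong (sym p)) ⟫ łukasiewicz x y

  ¬⊕≈𝟙⇒≤ : ∀ {x y} → ¬ x ⊕ y ≈ 𝟙 → x ≤ y
  ¬⊕≈𝟙⇒≤ {x} {y} p = y ⊖ x , (¬⊕≈𝟙⇒≈∨ p ⟫ comm _ x)

  ⊕≈𝟙⇒¬≤ : ∀ {x y} → x ⊕ y ≈ 𝟙 → ¬ x ≤ y
  ⊕≈𝟙⇒¬≤ {x} {y} p = ¬⊕≈𝟙⇒≤ (∙-congʳ (¬¬ x) ⟫ p)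

  ≤-refl : ∀ {x} → x ≤ x
  ≤-refl {x} = 𝟘 , sym (identityʳ x)

  ≤-reflexive : ∀ {x y} → x ≈ y → x ≤ y
  ≤-reflexive {x} {y} p = 𝟘 , (sym p ⟫ sym (identityʳ x))

  ≤-trans : ∀ {x y z} → x ≤ y → y ≤ z → x ≤ z
  ≤-trans {x} {y} {z} (u , p) (v , q) = u ⊕ v , (q ⟫ ∙-congʳ p ⟫ assoc x u v)

  ≤-resp-≈ : ∀ {x x' y y'} → x ≈ x' → y ≈ y' → x ≤ y → x' ≤ y'
  ≤-resp-≈ p q (z , r) = z , (sym q ⟫ r ⟫ ∙-congʳ p)

  ≤-antisym : ∀ {x y} → x ≤ y → y ≤ x → x ≈ y
  ≤-antisym {x} {y} p q =
    sym (¬⊕≈𝟙⇒≈∨ (≤⇒¬⊕≈𝟙 p) ⟫ ∙-congʳ (¬-cong (≤⇒¬⊕≈𝟙 q) ⟫ ¬𝟙≈𝟘) ⟫ identityˡ x)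

  x≤x⊕y : ∀ {x y} → x ≤ x ⊕ y
  x≤x⊕y {x} {y} = y , refl

  y≤x⊕y : ∀ {x y} → y ≤ x ⊕ y
  y≤x⊕y {x} {y} = x , comm x y

  x≤𝟙 : ∀ {x} → x ≤ 𝟙
  x≤𝟙 {x} = ¬ x , sym (⊕-complementʳ x)

  𝟘≤x : ∀ {x} → 𝟘 ≤ x
  𝟘≤x {x} = x , sym (identityˡ x)

  𝟙≤⇒≈𝟙 : ∀ {x} → 𝟙 ≤ x → x ≈ 𝟙
  𝟙≤⇒≈𝟙 p = ≤-antisym x≤𝟙 p

  ⊕-monoˡ-≤ : ∀ {x y w} → x ≤ y → x ⊕ w ≤ y ⊕ w
  ⊕-monoˡ-≤ {x} {y} {w} (z , p) = z , (∙-congʳ p ⟫ xy∙z≈xz∙y x z w)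

  ⊕-monoʳ-≤ : ∀ {x y w} → x ≤ y → w ⊕ x ≤ w ⊕ y
  ⊕-monoʳ-≤ {x} {y} {w} p = ≤-resp-≈ (comm x w) (comm y w) (⊕-monoˡ-≤ p)

  ⊕-mono-≤ : ∀ {x y u v} → x ≤ y → u ≤ v → x ⊕ u ≤ y ⊕ v
  ⊕-mono-≤ p q = ≤-trans (⊕-monoˡ-≤ p) (⊕-monoʳ-≤ q)

  ¬-antimono-≤ : ∀ {x y} → x ≤ y → ¬ y ≤ ¬ x
  ¬-antimono-≤ {x} {y} p = ¬⊕≈𝟙⇒≤ (∙-congʳ (¬¬ y) ⟫ comm y (¬ x) ⟫ ≤⇒¬⊕≈𝟙 p)

  ⊖-monoˡ-≤ : ∀ {x y w} → x ≤ y → x ⊖ w ≤ y ⊖ w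
  ⊖-monoˡ-≤ p = ¬-antimono-≤ (⊕-monoˡ-≤ (¬-antimono-≤ p))

  x⊖y≤x : ∀ {x y} → x ⊖ y ≤ x
  x⊖y≤x {x} {y} =
    ¬⊕≈𝟙⇒≤ (∙-congʳ (¬¬ _) ⟫ xy∙z≈xz∙y (¬ x) y x ⟫ ∙-congʳ (⊕-complementˡ x) ⟫ ⊕-absorbˡ y)

  x⊖x≈𝟘 : ∀ x → x ⊖ x ≈ 𝟘
  x⊖x≈𝟘 x = ¬-cong (⊕-complementˡ x) ⟫ ¬𝟙≈𝟘

  x⊖𝟘≈x : ∀ x → x ⊖ 𝟘 ≈ x
  x⊖𝟘≈x x = ¬-cong (identityʳ (¬ x)) ⟫ ¬¬ x

  ⊕⊖-cancel : ∀ {a d} → d ≤ ¬ a → (a ⊕ d) ⊖ a ≈ d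
  ⊕⊖-cancel {a} {d} p = ¬-injective
    (¬¬ _ ⟫ ∙-congʳ (¬-cong (comm a d ⟫ ∙-congʳ (sym (¬¬ d)))) ⟫ łukasiewicz (¬ d) a
     ⟫ ∙-congʳ (¬-cong (comm (¬ a) (¬ d) ⟫ ≤⇒¬⊕≈𝟙 p) ⟫ ¬𝟙≈𝟘) ⟫ identityˡ (¬ d))

  x≤x∨y : ∀ {x y} → x ≤ x ∨ y
  x≤x∨y {x} {y} = ≤-resp-≈ refl (∨-comm y x) y≤x⊕y

  y≤x∨y : ∀ {x y} → y ≤ x ∨ y
  y≤x∨y = y≤x⊕y

  ≤⇒∨≈ : ∀ {y z} → y ≤ z → z ∨ y ≈ z
  ≤⇒∨≈ p = sym (¬⊕≈𝟙⇒≈∨ (≤⇒¬⊕≈𝟙 p))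

  ∨-least : ∀ {x y z} → x ≤ z → y ≤ z → x ∨ y ≤ z
  ∨-least p q = ≤-trans (⊕-monoˡ-≤ (⊖-monoˡ-≤ p)) (≤-reflexive (≤⇒∨≈ q))

  ·-cong : ∀ n {x y} → x ≈ y → n · x ≈ n · y
  ·-cong zero    p = refl
  ·-cong (suc n) p = ∙-cong p (·-cong n p)

  ·-mono-≤ : ∀ n {x y} → x ≤ y → n · x ≤ n · y
  ·-mono-≤ zero    p = ≤-refl
  ·-mono-≤ (suc n) p = ⊕-mono-≤ p (·-mono-≤ n p)

  ·𝟘≈𝟘 : ∀ n → n · 𝟘 ≈ 𝟘
  ·𝟘≈𝟘 zero    = refl
  ·𝟘≈𝟘 (suc n) = identityˡ _ ⟫ ·𝟘≈𝟘 n

  4·≈double-double : ∀ a → 4 · a ≈ (a ⊕ a) ⊕ (a ⊕ a)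
  4·≈double-double a = ∙-congˡ (∙-congˡ (∙-congˡ (identityʳ a))) ⟫ sym (assoc a a (a ⊕ a))

  Trivial : Set ℓ
  Trivial = 𝟘 ≈ 𝟙

  trivial⇒≈ : Trivial → ∀ x y → x ≈ y
  trivial⇒≈ t x y = ≈𝟙 x ⟫ sym (≈𝟙 y)
    where
    ≈𝟙 : ∀ x → x ≈ 𝟙
    ≈𝟙 x = sym (identityʳ x) ⟫ ∙-congˡ t ⟫ ⊕-absorb x

  Inf : Carrier → Set (c ⊔ ℓ)
  Inf = Infinitesimal

  CoInf : Carrier → Set (c ⊔ ℓ)
  CoInf x = ∃ λ y → Inf y × x ≈ ¬ y

  trivial⇒Inf : Trivial → ∀ x → Inf x
  trivial⇒Inf t x n = 𝟘 , trivial⇒≈ t _ _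

  Inf-resp : ∀ {x y} → x ≈ y → Inf x → Inf y
  Inf-resp p i n = ≤-resp-≈ (·-cong (suc n) p) (¬-cong p) (i n)

  CoInf-resp : ∀ {x y} → x ≈ y → CoInf x → CoInf y
  CoInf-resp p (z , iz , e) = z , iz , (sym p ⟫ e)

  CoInf⇒Inf¬ : ∀ {x} → CoInf x → Inf (¬ x)
  CoInf⇒Inf¬ {x} (y , iy , e) = Inf-resp (sym (¬-cong e ⟫ ¬¬ y)) iy

  Inf-𝟘 : Inf 𝟘
  Inf-𝟘 n = ≤-resp-≈ (sym (·𝟘≈𝟘 (suc n))) refl 𝟘≤x

  Inf-≤ : ∀ {x a} → x ≤ a → Inf a → Inf x
  Inf-≤ p i n = ≤-trans (·-mono-≤ (suc n) p) (≤-trans (i n) (¬-antimono-≤ p))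

  Inf⇒≤¬ : ∀ {a} → Inf a → a ≤ ¬ a
  Inf⇒≤¬ {a} i = ≤-resp-≈ (identityʳ a) refl (i 0)

  Inf-⊖ : ∀ {a w} → Inf a → Inf (a ⊖ w)
  Inf-⊖ = Inf-≤ x⊖y≤x

  Inf-·≈𝟙⇒Trivial : ∀ {a} → Inf a → ∀ n → n · a ≈ 𝟙 → Trivial
  Inf-·≈𝟙⇒Trivial i zero    p = p
  Inf-·≈𝟙⇒Trivial {a} i (suc m) p = sym (·𝟘≈𝟘 (suc m)) ⟫ sym (·-cong (suc m) a≈𝟘) ⟫ p
    where
    a≈𝟘 : a ≈ 𝟘
    a≈𝟘 = sym (¬¬ a) ⟫ ¬-cong (𝟙≤⇒≈𝟙 (≤-resp-≈ p refl (i m))) ⟫ ¬𝟙≈𝟘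

  CoInf⇒⊕self≈𝟙 : ∀ {x} → CoInf x → x ⊕ x ≈ 𝟙
  CoInf⇒⊕self≈𝟙 {x} (y , iy , e) = 𝟙≤⇒≈𝟙 (≤-resp-≈ (∙-congʳ e ⟫ ⊕-complementˡ y) refl (⊕-monoʳ-≤ y≤x))
    where
    y≤x : y ≤ x
    y≤x = ≤-resp-≈ refl (sym e) (Inf⇒≤¬ iy)

  Inf∧CoInf⇒Trivial : ∀ {x} → Inf x → CoInf x → Trivial
  Inf∧CoInf⇒Trivial {x} i co = Inf-·≈𝟙⇒Trivial i 2 (∙-congˡ (identityʳ x) ⟫ CoInf⇒⊕self≈𝟙 co)

module PerfectMVAlgebraProperties {c ℓ} (PA : PerfectMVAlgebra c ℓ) where
  open PerfectMVAlgebra PA public using (perfect)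
  open MVAlgebraProperties (PerfectMVAlgebra.mvAlgebra PA) public

  -- If a ⊕ b were co-infinitesimal then 2a ⊕ 2b = 𝟙; perfection of 2a then forces
  -- 4a = 𝟙 or 4b = 𝟙, and an infinitesimal with a multiple equal to 𝟙 trivialises A.
  Inf-⊕ : ∀ {a b} → Inf a → Inf b → Inf (a ⊕ b)
  Inf-⊕ {a} {b} ia ib with perfect (a ⊕ b)
  ... | inj₁ i  = i
  ... | inj₂ co = trivial⇒Inf (trivial (perfect (a ⊕ a))) _
    where
    2a⊕2b≈𝟙 : (a ⊕ a) ⊕ (b ⊕ b) ≈ 𝟙
    2a⊕2b≈𝟙 = interchange a a b b ⟫ CoInf⇒⊕self≈𝟙 co

    trivial : Inf (a ⊕ a) ⊎ CoInf (a ⊕ a) → Trivial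
    trivial (inj₂ co2a) = Inf-·≈𝟙⇒Trivial ia 4 (4·≈double-double a ⟫ CoInf⇒⊕self≈𝟙 co2a)
    trivial (inj₁ i2a)  = Inf-·≈𝟙⇒Trivial ib 4 (4·≈double-double b ⟫ 𝟙≤⇒≈𝟙 (≤-resp-≈
      (CoInf⇒⊕self≈𝟙 (a ⊕ a , i2a , refl)) refl (⊕-mono-≤ ¬2a≤2b ¬2a≤2b)))
      where
      ¬2a≤2b : ¬ (a ⊕ a) ≤ b ⊕ b
      ¬2a≤2b = ⊕≈𝟙⇒¬≤ 2a⊕2b≈𝟙

  Inf-∨ : ∀ {a b} → Inf a → Inf b → Inf (a ∨ b)
  Inf-∨ ia ib = Inf-⊕ (Inf-⊖ ia) ib

  Inf⇒≤¬Inf : ∀ {a b} → Inf a → Inf b → a ≤ ¬ b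
  Inf⇒≤¬Inf ia ib = ≤-trans x≤x⊕y (≤-trans (Inf⇒≤¬ (Inf-⊕ ia ib)) (¬-antimono-≤ y≤x⊕y))

  Inf-⊕-cancelˡ : ∀ {a b d} → Inf a → Inf b → Inf d → a ⊕ b ≈ a ⊕ d → b ≈ d
  Inf-⊕-cancelˡ ia ib id p =
    sym (⊕⊖-cancel (Inf⇒≤¬Inf ib ia)) ⟫ ⊖-cong p refl ⟫ ⊕⊖-cancel (Inf⇒≤¬Inf id ia)

  Inf-⊕-cancelˡ-≤ : ∀ {a b d} → Inf a → Inf b → Inf d → a ⊕ b ≤ a ⊕ d → b ≤ d
  Inf-⊕-cancelˡ-≤ ia ib id p =
    ≤-resp-≈ (⊕⊖-cancel (Inf⇒≤¬Inf ib ia)) (⊕⊖-cancel (Inf⇒≤¬Inf id ia)) (⊖-monoˡ-≤ p)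

  Inf-⊕-distribˡ-∨ : ∀ {a b d} → Inf a → Inf b → Inf d → a ⊕ (b ∨ d) ≈ (a ⊕ b) ∨ (a ⊕ d)
  Inf-⊕-distribˡ-∨ {a} {b} {d} ia ib id =
    ≤-antisym a⊕[b∨d]≤w (∨-least (⊕-monoʳ-≤ x≤x∨y) (⊕-monoʳ-≤ y≤x∨y))
    where
    w = (a ⊕ b) ∨ (a ⊕ d)
    a≤w : a ≤ w
    a≤w = ≤-trans x≤x⊕y x≤x∨y
    u = proj₁ a≤w
    w≈a⊕u : w ≈ a ⊕ u
    w≈a⊕u = proj₂ a≤w
    iu : Inf u
    iu = Inf-≤ (≤-resp-≈ refl (sym w≈a⊕u) y≤x⊕y) (Inf-∨ (Inf-⊕ ia ib) (Inf-⊕ ia id))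
    a⊕[b∨d]≤w : a ⊕ (b ∨ d) ≤ w
    a⊕[b∨d]≤w = ≤-resp-≈ refl (sym w≈a⊕u) (⊕-monoʳ-≤ (∨-least
      (Inf-⊕-cancelˡ-≤ ia ib iu (≤-resp-≈ refl w≈a⊕u x≤x∨y))
      (Inf-⊕-cancelˡ-≤ ia id iu (≤-resp-≈ refl w≈a⊕u y≤x∨y))))

  [a∨b]⊖b≈a⊖b : ∀ {a b} → Inf a → Inf b → (a ∨ b) ⊖ b ≈ a ⊖ b
  [a∨b]⊖b≈a⊖b {a} {b} ia ib = ⊖-cong (comm _ b) refl ⟫ ⊕⊖-cancel (Inf⇒≤¬Inf (Inf-⊖ ia) ib)

  radOf : (x : Carrier) → Inf x ⊎ CoInf x → Carrier
  radOf x (inj₁ _) = x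
  radOf x (inj₂ _) = ¬ x

  rad : Carrier → Carrier
  rad x = radOf x (perfect x)

  Inf-rad : ∀ x → Inf (rad x)
  Inf-rad x with perfect x
  ... | inj₁ i  = i
  ... | inj₂ co = CoInf⇒Inf¬ co

  rad-Inf : ∀ {x} → Inf x → rad x ≈ x
  rad-Inf {x} i with perfect x
  ... | inj₁ _  = refl
  ... | inj₂ co = trivial⇒≈ (Inf∧CoInf⇒Trivial i co) _ _

  radOf-cong : ∀ {x y} dx dy → x ≈ y → radOf x dx ≈ radOf y dy
  radOf-cong (inj₁ _)  (inj₁ _)  p = p
  radOf-cong (inj₂ _)  (inj₂ _)  p = ¬-cong p
  radOf-cong (inj₁ ix) (inj₂ cy) p = trivial⇒≈ (Inf∧CoInf⇒Trivial (Inf-resp p ix) cy) _ _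
  radOf-cong (inj₂ cx) (inj₁ iy) p = trivial⇒≈ (Inf∧CoInf⇒Trivial iy (CoInf-resp p cx)) _ _

  rad-cong : ∀ {x y} → x ≈ y → rad x ≈ rad y
  rad-cong {x} {y} = radOf-cong (perfect x) (perfect y)

module IdempotentSemifieldProperties {c ℓ} (F : IdempotentSemifield c ℓ) (em : ExcludedMiddle (c ⊔ ℓ))
  where
  open IdempotentSemifield F public
  open CommutativeSemigroupProperties *-commutativeSemigroup public
    using () renaming (interchange to *-interchange)

  infixr 3 _⟫_
  _⟫_ : ∀ {x y z} → x ≈ y → y ≈ z → x ≈ z
  _⟫_ = trans

  infix 4 _≤_
  _≤_ : Carrier → Carrier → Set ℓ
  x ≤ y = x + y ≈ y

  Trivial : Set ℓ
  Trivial = 0# ≈ 1#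

  trivial⇒≈ : Trivial → ∀ x y → x ≈ y
  trivial⇒≈ t x y = ≈0 x ⟫ sym (≈0 y)
    where
    ≈0 : ∀ x → x ≈ 0#
    ≈0 x = sym (*-identityʳ x) ⟫ *-congˡ (sym t) ⟫ zeroʳ x

  -- Weaker than x ≉ 0#: in the trivial semifield every element is a unit.
  Unit : Carrier → Set ℓ
  Unit x = x ≈ 0# → Trivial

  infix 8 _⁻¹
  _⁻¹ : Carrier → Carrier
  x ⁻¹ with em {Lift c (x ≈ 0#)}
  ... | yes _   = 0#
  ... | no x≉0 = proj₁ (inverse x (x≉0 ∘ lift))

  inverseʳ : ∀ {x} → Unit x → x * x ⁻¹ ≈ 1#
  inverseʳ {x} u with em {Lift c (x ≈ 0#)}
  ... | yes (lift x≈0) = trivial⇒≈ (u x≈0) _ _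
  ... | no x≉0        = proj₂ (inverse x (x≉0 ∘ lift))

  inverseˡ : ∀ {x} → Unit x → x ⁻¹ * x ≈ 1#
  inverseˡ {x} u = *-comm (x ⁻¹) x ⟫ inverseʳ u

  *≈1⇒Unit : ∀ {x y} → x * y ≈ 1# → Unit x
  *≈1⇒Unit {x} {y} p x≈0 = sym (sym p ⟫ *-congʳ x≈0 ⟫ zeroˡ y)

  inverse-unique : ∀ {x a b} → x * a ≈ 1# → x * b ≈ 1# → a ≈ b
  inverse-unique {x} {a} {b} p q = sym (*-identityʳ a) ⟫ *-congˡ (sym q) ⟫ sym (*-assoc a x b)
    ⟫ *-congʳ (*-comm a x ⟫ p) ⟫ *-identityˡ b

  *≈1⇒≈⁻¹ : ∀ {x y} → x * y ≈ 1# → y ≈ x ⁻¹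
  *≈1⇒≈⁻¹ p = inverse-unique p (inverseʳ (*≈1⇒Unit p))

  ⁻¹-cong : ∀ {x y} → x ≈ y → x ⁻¹ ≈ y ⁻¹
  ⁻¹-cong {x} {y} p with em {Lift c (x ≈ 0#)} | em {Lift c (y ≈ 0#)}
  ... | yes _          | yes _          = refl
  ... | yes (lift x≈0) | no y≉0         = ⊥-elim (y≉0 (lift (sym p ⟫ x≈0)))
  ... | no x≉0         | yes (lift y≈0) = ⊥-elim (x≉0 (lift (p ⟫ y≈0)))
  ... | no x≉0         | no y≉0         =
    inverse-unique (proj₂ (inverse x (x≉0 ∘ lift))) (*-congʳ p ⟫ proj₂ (inverse y (y≉0 ∘ lift)))

  Unit-⁻¹ : ∀ {x} → Unit x → Unit (x ⁻¹)
  Unit-⁻¹ u = *≈1⇒Unit (inverseˡ u)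

  ⁻¹-involutive : ∀ {x} → Unit x → x ⁻¹ ⁻¹ ≈ x
  ⁻¹-involutive u = sym (*≈1⇒≈⁻¹ (inverseˡ u))

  xy*x⁻¹y⁻¹≈1 : ∀ {x y} → Unit x → Unit y → (x * y) * (x ⁻¹ * y ⁻¹) ≈ 1#
  xy*x⁻¹y⁻¹≈1 {x} {y} ux uy =
    *-interchange x y (x ⁻¹) (y ⁻¹) ⟫ *-cong (inverseʳ ux) (inverseʳ uy) ⟫ *-identityˡ 1#

  Unit-* : ∀ {x y} → Unit x → Unit y → Unit (x * y)
  Unit-* ux uy = *≈1⇒Unit (xy*x⁻¹y⁻¹≈1 ux uy)

  ⁻¹-distrib-* : ∀ {x y} → Unit x → Unit y → (x * y) ⁻¹ ≈ x ⁻¹ * y ⁻¹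
  ⁻¹-distrib-* ux uy = sym (*≈1⇒≈⁻¹ (xy*x⁻¹y⁻¹≈1 ux uy))

  1⁻¹≈1 : 1# ⁻¹ ≈ 1#
  1⁻¹≈1 = sym (*≈1⇒≈⁻¹ (*-identityˡ 1#))

  Unit-+ : ∀ {x y} → Unit x → Unit (x + y)
  Unit-+ {x} {y} u p = u (sym (+-identityʳ x) ⟫ +-congˡ (sym p) ⟫ sym (+-assoc x x y)
    ⟫ +-congʳ (+-idem x) ⟫ p)

  y*x*x⁻¹≈y : ∀ {x} → Unit x → ∀ y → (y * x) * x ⁻¹ ≈ y
  y*x*x⁻¹≈y {x} u y = *-assoc y x (x ⁻¹) ⟫ *-congˡ (inverseʳ u) ⟫ *-identityʳ y

  y*x⁻¹*x≈y : ∀ {x} → Unit x → ∀ y → (y * x ⁻¹) * x ≈ y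
  y*x⁻¹*x≈y {x} u y = *-assoc y (x ⁻¹) x ⟫ *-congˡ (inverseˡ u) ⟫ *-identityʳ y

  [a*b⁻¹+1]*b≈a+b : ∀ {b} → Unit b → ∀ a → (a * b ⁻¹ + 1#) * b ≈ a + b
  [a*b⁻¹+1]*b≈a+b {b} ub a = distribʳ b (a * b ⁻¹) 1# ⟫ +-cong (y*x⁻¹*x≈y ub a) (*-identityˡ b)

  1≤x+1 : ∀ x → 1# ≤ x + 1#
  1≤x+1 x = +-comm 1# (x + 1#) ⟫ +-assoc x 1# 1# ⟫ +-congˡ (+-idem 1#)

  1≤⇒+1≈ : ∀ {x} → 1# ≤ x → x + 1# ≈ x
  1≤⇒+1≈ {x} p = +-comm x 1# ⟫ p

  1≤⇒Unit : ∀ {x} → 1# ≤ x → Unit x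
  1≤⇒Unit {x} p x≈0 = sym (sym (+-identityʳ 1#) ⟫ +-congˡ (sym x≈0) ⟫ p ⟫ x≈0)

  1≤-* : ∀ {x y} → 1# ≤ x → 1# ≤ y → 1# ≤ x * y
  1≤-* {x} {y} px py = sym (*-congʳ (sym px) ⟫ distribʳ y 1# x ⟫ +-congʳ (*-identityˡ y ⟫ sym py)
    ⟫ +-assoc 1# y (x * y) ⟫ +-congˡ (+-congʳ (sym (*-identityˡ y)) ⟫ sym (distribʳ y 1# x) ⟫ *-congʳ px))

  1≤-+ : ∀ {x} y → 1# ≤ x → 1# ≤ x + y
  1≤-+ {x} y p = sym (+-assoc 1# x y) ⟫ +-congʳ p

  1≤⇒⁻¹≤1 : ∀ {x} → 1# ≤ x → x ⁻¹ ≤ 1#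
  1≤⇒⁻¹≤1 {x} p = +-cong (sym (*-identityʳ (x ⁻¹))) (sym (inverseˡ (1≤⇒Unit p)))
    ⟫ sym (distribˡ (x ⁻¹) 1# x) ⟫ *-congˡ p ⟫ inverseˡ (1≤⇒Unit p)

  -- (x ∨ 1)/a ∨ 1 = x/a ∨ 1/a ∨ 1, and 1/a ≤ 1.
  [x+1]*a⁻¹+1≈x*a⁻¹+1 : ∀ {a} → 1# ≤ a → ∀ x → (x + 1#) * a ⁻¹ + 1# ≈ x * a ⁻¹ + 1#
  [x+1]*a⁻¹+1≈x*a⁻¹+1 {a} p x = +-congʳ (distribʳ (a ⁻¹) x 1#) ⟫ +-assoc _ _ _
    ⟫ +-congˡ (+-congʳ (*-identityˡ (a ⁻¹)) ⟫ 1≤⇒⁻¹≤1 p)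

module PerfectMVAlgebraOf {c ℓ} (F : IdempotentSemifield c ℓ) (em : ExcludedMiddle (c ⊔ ℓ)) where
  open IdempotentSemifieldProperties F em

  -- (false , a) stands for the element a + 1# ≥ 1# of the positive cone, viewed as an
  -- infinitesimal, and (true , a) for its negation; reading a as a + 1# avoids a subtype.
  M : Set c
  M = Bool × Carrier

  value : M → Carrier
  value (_ , a) = a + 1#

  infix 4 _≈M_
  record _≈M_ (x y : M) : Set ℓ where
    constructor _,_
    field
      flags  : proj₁ x ≡ proj₁ y ⊎ Trivial
      values : value x ≈ value y

  same-flag : ∀ {b x y} → x + 1# ≈ y + 1# → (b , x) ≈M (b , y)
  same-flag = inj₁ ≡.refl ,_

  ≈M-refl : ∀ {x} → x ≈M x
  ≈M-refl = same-flag refl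

  ≈M-sym : ∀ {x y} → x ≈M y → y ≈M x
  ≈M-sym (f , p) = Sum.map ≡.sym id f , sym p

  ≈M-trans : ∀ {x y z} → x ≈M y → y ≈M z → x ≈M z
  ≈M-trans (inj₁ ≡.refl , p) (f , q) = f , trans p q
  ≈M-trans (inj₂ t , p)      (_ , q) = inj₂ t , trans p q

  trivial⇒≈M : Trivial → ∀ x y → x ≈M y
  trivial⇒≈M t x y = inj₂ t , trivial⇒≈ t _ _

  ≈M-flags-≢⇒Trivial : ∀ {x y} → x ≈M y → (proj₁ x ≡ proj₁ y → ⊥) → Trivial
  ≈M-flags-≢⇒Trivial (inj₁ eq , _) ≢ = ⊥-elim (≢ eq)
  ≈M-flags-≢⇒Trivial (inj₂ t , _)  _ = t

  -- Writing ε a for the infinitesimal of value a: ε a ⊕ ε b = ε (a b),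
  -- ε a ⊕ ¬ ε b = ¬ ε (b / a ∨ 1) and ¬ ε a ⊕ ¬ ε b = 𝟙.
  add : Bool → Bool → Carrier → Carrier → M
  add false false a b = false , a * b
  add false true  a b = true , b * a ⁻¹
  add true  false a b = true , a * b ⁻¹
  add true  true  a b = true , 0#

  infixl 6 _⊕M_
  _⊕M_ : M → M → M
  x ⊕M y = add (proj₁ x) (proj₁ y) (value x) (value y)

  ¬M : M → M
  ¬M (b , x) = not b , x

  𝟘M : M
  𝟘M = false , 0#

  add-cong : ∀ p q {a a' b b'} → a ≈ a' → b ≈ b' → add p q a b ≈M add p q a' b'
  add-cong false false a b = same-flag (+-congʳ (*-cong a b))
  add-cong false true  a b = same-flag (+-congʳ (*-cong b (⁻¹-cong a)))
  add-cong true  false a b = same-flag (+-congʳ (*-cong a (⁻¹-cong b)))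
  add-cong true  true  a b = ≈M-refl

  ⊕M-cong : ∀ {x x' y y'} → x ≈M x' → y ≈M y' → x ⊕M y ≈M x' ⊕M y'
  ⊕M-cong {p , _} {_ , _} {q , _} (inj₁ ≡.refl , a) (inj₁ ≡.refl , b) = add-cong p q a b
  ⊕M-cong (inj₁ _ , _) (inj₂ t , _) = trivial⇒≈M t _ _
  ⊕M-cong (inj₂ t , _) _            = trivial⇒≈M t _ _

  add-comm : ∀ p q a b → add p q a b ≈M add q p b a
  add-comm false false a b = same-flag (+-congʳ (*-comm a b))
  add-comm false true  a b = ≈M-refl
  add-comm true  false a b = ≈M-refl
  add-comm true  true  a b = ≈M-refl

  ⊕M-comm : ∀ x y → x ⊕M y ≈M y ⊕M x
  ⊕M-comm (p , _) (q , _) = add-comm p q _ _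

  [0+1]⁻¹≈1 : (0# + 1#) ⁻¹ ≈ 1#
  [0+1]⁻¹≈1 = ⁻¹-cong (+-identityˡ 1#) ⟫ 1⁻¹≈1

  ⊕M-identityˡ : ∀ x → 𝟘M ⊕M x ≈M x
  ⊕M-identityˡ (false , b) =
    same-flag (+-congʳ (*-congʳ (+-identityˡ 1#) ⟫ *-identityˡ _) ⟫ 1≤⇒+1≈ (1≤x+1 b))
  ⊕M-identityˡ (true , b) =
    same-flag (+-congʳ (*-congˡ [0+1]⁻¹≈1 ⟫ *-identityʳ _) ⟫ 1≤⇒+1≈ (1≤x+1 b))

  ⊕M-identityʳ : ∀ x → x ⊕M 𝟘M ≈M x
  ⊕M-identityʳ x = ≈M-trans (⊕M-comm x 𝟘M) (⊕M-identityˡ x)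

  x*[ab+1]⁻¹≈x*b⁻¹*a⁻¹ : ∀ {a b} → 1# ≤ a → 1# ≤ b → ∀ x → x * (a * b + 1#) ⁻¹ ≈ (x * b ⁻¹) * a ⁻¹
  x*[ab+1]⁻¹≈x*b⁻¹*a⁻¹ pa pb x =
    *-congˡ (⁻¹-cong (1≤⇒+1≈ (1≤-* pa pb)) ⟫ ⁻¹-distrib-* (1≤⇒Unit pa) (1≤⇒Unit pb) ⟫ *-comm _ _)
    ⟫ sym (*-assoc x _ _)

  add-assoc : ∀ p q s {a b d} → 1# ≤ a → 1# ≤ b → 1# ≤ d →
    add (proj₁ (add p q a b)) s (value (add p q a b)) d
      ≈M add p (proj₁ (add q s b d)) a (value (add q s b d))
  add-assoc false false false {a} {b} {d} pa pb pd = same-flag (+-congʳ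
    (*-congʳ (1≤⇒+1≈ (1≤-* pa pb)) ⟫ *-assoc a b d ⟫ *-congˡ (sym (1≤⇒+1≈ (1≤-* pb pd)))))
  add-assoc false false true {a} {b} {d} pa pb pd = same-flag
    (+-congʳ (x*[ab+1]⁻¹≈x*b⁻¹*a⁻¹ pa pb d) ⟫ sym ([x+1]*a⁻¹+1≈x*a⁻¹+1 pa (d * b ⁻¹)))
  add-assoc false true false {a} {b} {d} pa pb pd = same-flag
    ([x+1]*a⁻¹+1≈x*a⁻¹+1 pd (b * a ⁻¹)
     ⟫ +-congʳ (*-assoc b _ _ ⟫ *-congˡ (*-comm _ _) ⟫ sym (*-assoc b _ _))
     ⟫ sym ([x+1]*a⁻¹+1≈x*a⁻¹+1 pa (b * d ⁻¹)))
  add-assoc false true true pa pb pd = same-flag (sym ([x+1]*a⁻¹+1≈x*a⁻¹+1 pa 0# ⟫ +-congʳ (zeroˡ _)))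
  add-assoc true false false {a} {b} {d} pa pb pd = same-flag
    ([x+1]*a⁻¹+1≈x*a⁻¹+1 pd (a * b ⁻¹) ⟫ sym (+-congʳ (x*[ab+1]⁻¹≈x*b⁻¹*a⁻¹ pd pb a))
     ⟫ +-congʳ (*-congˡ (⁻¹-cong (+-congʳ (*-comm d b)))))
  add-assoc true false true  pa pb pd = ≈M-refl
  add-assoc true true false pa pb pd = same-flag ([x+1]*a⁻¹+1≈x*a⁻¹+1 pd 0# ⟫ +-congʳ (zeroˡ _))
  add-assoc true true true   pa pb pd = ≈M-refl

  ⊕M-assoc : ∀ x y z → (x ⊕M y) ⊕M z ≈M x ⊕M (y ⊕M z)
  ⊕M-assoc (p , a) (q , b) (s , d) = add-assoc p q s (1≤x+1 a) (1≤x+1 b) (1≤x+1 d)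

  ¬M-cong : ∀ {x y} → x ≈M y → ¬M x ≈M ¬M y
  ¬M-cong (f , p) = Sum.map (≡.cong not) id f , p

  ¬M-involutive : ∀ x → ¬M (¬M x) ≈M x
  ¬M-involutive (false , x) = ≈M-refl
  ¬M-involutive (true , x)  = ≈M-refl

  ⊕M-absorb : ∀ x → x ⊕M ¬M 𝟘M ≈M ¬M 𝟘M
  ⊕M-absorb (false , a) = same-flag ([x+1]*a⁻¹+1≈x*a⁻¹+1 (1≤x+1 a) 0# ⟫ +-congʳ (zeroˡ _))
  ⊕M-absorb (true , a)  = ≈M-refl

  b*[0+1]⁻¹+1≈[ba+1]*a⁻¹+1 : ∀ {a b} → 1# ≤ a → 1# ≤ b → b * (0# + 1#) ⁻¹ + 1# ≈ (b * a + 1#) * a ⁻¹ + 1#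
  b*[0+1]⁻¹+1≈[ba+1]*a⁻¹+1 {a} {b} pa pb = +-congʳ
    (*-congˡ [0+1]⁻¹≈1 ⟫ *-identityʳ b ⟫ sym (y*x*x⁻¹≈y (1≤⇒Unit pa) b)
     ⟫ *-congʳ (sym (1≤⇒+1≈ (1≤-* pb pa))))

  b*[b*a⁻¹+1]⁻¹≈[a⁻¹+b⁻¹]⁻¹ : ∀ {a b} → 1# ≤ a → 1# ≤ b → b * (b * a ⁻¹ + 1#) ⁻¹ ≈ (a ⁻¹ + b ⁻¹) ⁻¹
  b*[b*a⁻¹+1]⁻¹≈[a⁻¹+b⁻¹]⁻¹ {a} {b} pa pb =
    *-congˡ (⁻¹-cong e ⟫ ⁻¹-distrib-* ub (Unit-+ (Unit-⁻¹ ua))) ⟫ sym (*-assoc b (b ⁻¹) _)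
    ⟫ *-congʳ (inverseʳ ub) ⟫ *-identityˡ _
    where
    ua = 1≤⇒Unit pa
    ub = 1≤⇒Unit pb
    e : b * a ⁻¹ + 1# ≈ b * (a ⁻¹ + b ⁻¹)
    e = sym (distribˡ b (a ⁻¹) (b ⁻¹) ⟫ +-congˡ (inverseʳ ub))

  add-łukasiewicz : ∀ p q {a b} → 1# ≤ a → 1# ≤ b →
    add (not (proj₁ (add (not p) q a b))) q (value (add (not p) q a b)) b ≈M
    add (not (proj₁ (add (not q) p b a))) p (value (add (not q) p b a)) a
  add-łukasiewicz false false {a} {b} pa pb = same-flag (+-congʳ
    ([a*b⁻¹+1]*b≈a+b (1≤⇒Unit pb) a ⟫ +-comm a b ⟫ sym ([a*b⁻¹+1]*b≈a+b (1≤⇒Unit pa) b)))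
  add-łukasiewicz false true  pa pb = same-flag (b*[0+1]⁻¹+1≈[ba+1]*a⁻¹+1 pa pb)
  add-łukasiewicz true  false pa pb = same-flag (sym (b*[0+1]⁻¹+1≈[ba+1]*a⁻¹+1 pb pa))
  add-łukasiewicz true  true  pa pb = same-flag (+-congʳ
    (b*[b*a⁻¹+1]⁻¹≈[a⁻¹+b⁻¹]⁻¹ pa pb ⟫ ⁻¹-cong (+-comm _ _) ⟫ sym (b*[b*a⁻¹+1]⁻¹≈[a⁻¹+b⁻¹]⁻¹ pb pa)))

  ⊕M-łukasiewicz : ∀ x y → ¬M (¬M x ⊕M y) ⊕M y ≈M ¬M (¬M y ⊕M x) ⊕M x
  ⊕M-łukasiewicz (p , a) (q , b) = add-łukasiewicz p q (1≤x+1 a) (1≤x+1 b)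

  mvAlgebra : MVAlgebra c ℓ
  mvAlgebra = record
    { Carrier = M
    ; _≈_ = _≈M_
    ; _⊕_ = _⊕M_
    ; ¬_ = ¬M
    ; 𝟘 = 𝟘M
    ; isCommutativeMonoid = record
      { isMonoid = record
        { isSemigroup = record
          { isMagma = record
            { isEquivalence = record { refl = ≈M-refl ; sym = ≈M-sym ; trans = ≈M-trans }
            ; ∙-cong = ⊕M-cong }
          ; assoc = ⊕M-assoc }
        ; identity = ⊕M-identityˡ , ⊕M-identityʳ }
      ; comm = ⊕M-comm }
    ; ¬-cong = ¬M-cong
    ; ¬¬ = ¬M-involutive
    ; ⊕-absorb = ⊕M-absorb
    ; łukasiewicz = ⊕M-łukasiewicz
    }

  open MVAlgebra mvAlgebra using (_·_; Infinitesimal; Perfect) renaming (_≤_ to _≤M_)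

  flag-· : ∀ n a → proj₁ (n · (false , a)) ≡ false
  flag-· zero    a = ≡.refl
  flag-· (suc n) a rewrite flag-· n a = ≡.refl

  false≤true : ∀ {x} → proj₁ x ≡ false → ∀ a → x ≤M (true , a)
  false≤true {false , b} ≡.refl a = (true , (a + 1#) * (b + 1#)) , same-flag (sym
    (+-congʳ (*-congʳ (1≤⇒+1≈ (1≤-* (1≤x+1 a) (1≤x+1 b))) ⟫ y*x*x⁻¹≈y (1≤⇒Unit (1≤x+1 b)) (a + 1#))
     ⟫ 1≤⇒+1≈ (1≤x+1 a)))

  Infinitesimal-false : ∀ a → Infinitesimal (false , a)
  Infinitesimal-false a n = false≤true (flag-· (suc n) a) a

  perfect : Perfect
  perfect (false , a) = inj₁ (Infinitesimal-false a)
  perfect (true , a)  = inj₂ ((false , a) , Infinitesimal-false a , ≈M-refl)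

  perfectMVAlgebra : PerfectMVAlgebra c ℓ
  perfectMVAlgebra = record { mvAlgebra = mvAlgebra ; perfect = perfect }

module PerfectMVHomOf {c ℓ} (F F' : IdempotentSemifield c ℓ) (em : ExcludedMiddle (c ⊔ ℓ))
                      (φ : SemiringHom F F') where
  module S  = IdempotentSemifieldProperties F em
  module T  = IdempotentSemifieldProperties F' em
  module MS = PerfectMVAlgebraOf F em
  module MT = PerfectMVAlgebraOf F' em
  open SemiringMorphisms.IsSemiringHomomorphism (proj₂ φ)
  open T using (_⟫_)

  f : S.Carrier → T.Carrier
  f = proj₁ φ

  f-+1 : ∀ x → f (x S.+ S.1#) T.≈ f x T.+ T.1#
  f-+1 x = +-homo x S.1# ⟫ T.+-congˡ 1#-homo

  f-⁻¹ : ∀ {a} → S.Unit a → f (a S.⁻¹) T.≈ f a T.⁻¹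
  f-⁻¹ {a} u = T.*≈1⇒≈⁻¹ (T.sym (*-homo a (a S.⁻¹)) ⟫ ⟦⟧-cong (S.inverseʳ u) ⟫ 1#-homo)

  f-Trivial : S.Trivial → T.Trivial
  f-Trivial t = T.sym 0#-homo ⟫ ⟦⟧-cong t ⟫ 1#-homo

  Mf : MS.M → MT.M
  Mf (b , x) = b , f x

  Mf-cong : ∀ {x y} → x MS.≈M y → Mf x MT.≈M Mf y
  Mf-cong {_ , x} {_ , y} (fl MS., p) = Sum.map id f-Trivial fl MT., (T.sym (f-+1 x) ⟫ ⟦⟧-cong p ⟫ f-+1 y)

  Mf-add : ∀ p q {a b} → S.1# S.≤ a → S.1# S.≤ b → Mf (MS.add p q a b) MT.≈M MT.add p q (f a) (f b)
  Mf-add false false {a} {b} pa pb = MT.same-flag (T.+-congʳ (*-homo a b))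
  Mf-add false true  {a} {b} pa pb =
    MT.same-flag (T.+-congʳ (*-homo b (a S.⁻¹) ⟫ T.*-congˡ (f-⁻¹ (S.1≤⇒Unit pa))))
  Mf-add true  false {a} {b} pa pb =
    MT.same-flag (T.+-congʳ (*-homo a (b S.⁻¹) ⟫ T.*-congˡ (f-⁻¹ (S.1≤⇒Unit pb))))
  Mf-add true  true  pa pb = MT.same-flag (T.+-congʳ 0#-homo)

  Mf-⊕ : ∀ x y → Mf (x MS.⊕M y) MT.≈M Mf x MT.⊕M Mf y
  Mf-⊕ (p , a) (q , b) =
    MT.≈M-trans (Mf-add p q (S.1≤x+1 a) (S.1≤x+1 b)) (MT.add-cong p q (f-+1 a) (f-+1 b))

  mvHom : MVHom MS.mvAlgebra MT.mvAlgebra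
  mvHom = record
    { ⟦_⟧ = Mf
    ; cong = Mf-cong
    ; ⊕-homo = Mf-⊕
    ; ¬-homo = λ x → MT.≈M-refl
    ; 𝟘-homo = MT.same-flag (T.+-congʳ 0#-homo)
    }

-- A pair (a , b) of infinitesimals stands for the difference a − b in the lattice-ordered
-- group generated by Rad(A).
module RadicalDifferences {c ℓ} (PA : PerfectMVAlgebra c ℓ) where
  open PerfectMVAlgebraProperties PA public

  Pair : Set c
  Pair = Carrier × Carrier

  RadPair : Pair → Set (c ⊔ ℓ)
  RadPair (a , b) = Inf a × Inf b

  infix 4 _≐_ _≼_ _≈₂_
  _≐_ : Pair → Pair → Set ℓ
  (a , b) ≐ (d , e) = a ⊕ e ≈ d ⊕ b

  _≼_ : Pair → Pair → Set (c ⊔ ℓ)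
  (a , b) ≼ (d , e) = a ⊕ e ≤ d ⊕ b

  _≈₂_ : Pair → Pair → Set ℓ
  (a , b) ≈₂ (d , e) = (a ≈ d) × (b ≈ e)

  infixl 6 _+ᵖ_
  _+ᵖ_ : Pair → Pair → Pair
  (a , b) +ᵖ (d , e) = a ⊕ d , b ⊕ e

  infixl 5 _∨ᵖ_
  _∨ᵖ_ : Pair → Pair → Pair
  (a , b) ∨ᵖ (d , e) = (a ⊕ e) ∨ (d ⊕ b) , b ⊕ e

  negᵖ : Pair → Pair
  negᵖ (a , b) = b , a

  0ᵖ : Pair
  0ᵖ = 𝟘 , 𝟘

  RadPair-+ᵖ : ∀ x y → RadPair x → RadPair y → RadPair (x +ᵖ y)
  RadPair-+ᵖ x y (ia , ib) (id , ie) = Inf-⊕ ia id , Inf-⊕ ib ie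

  RadPair-∨ᵖ : ∀ x y → RadPair x → RadPair y → RadPair (x ∨ᵖ y)
  RadPair-∨ᵖ x y (ia , ib) (id , ie) = Inf-∨ (Inf-⊕ ia ie) (Inf-⊕ id ib) , Inf-⊕ ib ie

  RadPair-negᵖ : ∀ x → RadPair x → RadPair (negᵖ x)
  RadPair-negᵖ x (ia , ib) = ib , ia

  RadPair-0ᵖ : RadPair 0ᵖ
  RadPair-0ᵖ = Inf-𝟘 , Inf-𝟘

  ≈₂-refl : ∀ {x} → x ≈₂ x
  ≈₂-refl = refl , refl

  ≈₂-sym : ∀ {x y} → x ≈₂ y → y ≈₂ x
  ≈₂-sym (p , q) = sym p , sym q

  ≈₂-trans : ∀ {x y z} → x ≈₂ y → y ≈₂ z → x ≈₂ z
  ≈₂-trans (p , q) (p' , q') = trans p p' , trans q q'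

  +ᵖ-cong₂ : ∀ {x x' y y'} → x ≈₂ x' → y ≈₂ y' → x +ᵖ y ≈₂ x' +ᵖ y'
  +ᵖ-cong₂ (p , q) (p' , q') = ∙-cong p p' , ∙-cong q q'

  ∨ᵖ-cong₂ : ∀ {x x' y y'} → x ≈₂ x' → y ≈₂ y' → x ∨ᵖ y ≈₂ x' ∨ᵖ y'
  ∨ᵖ-cong₂ (p , q) (p' , q') = ∨-cong (∙-cong p q') (∙-cong p' q) , ∙-cong q q'

  ≈₂⇒≐ : ∀ x y → x ≈₂ y → x ≐ y
  ≈₂⇒≐ x y (p , q) = ∙-cong p (sym q)

  ≐-resp-≈₂ : ∀ {x x' y y'} → x ≈₂ x' → y ≈₂ y' → x ≐ y → x' ≐ y'
  ≐-resp-≈₂ (p , q) (p' , q') e = ∙-cong (sym p) (sym q') ⟫ e ⟫ ∙-cong p' q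

  ≐-sym : ∀ x y → x ≐ y → y ≐ x
  ≐-sym x y p = sym p

  ≐⇒≼ : ∀ x y → x ≐ y → x ≼ y
  ≐⇒≼ x y p = ≤-reflexive p

  ≼-refl : ∀ x → x ≼ x
  ≼-refl x = ≤-refl

  ≼-antisym : ∀ x y → x ≼ y → y ≼ x → x ≐ y
  ≼-antisym x y p q = ≤-antisym p q

  ≼-trans : ∀ x y z → RadPair x → RadPair y → RadPair z → x ≼ y → y ≼ z → x ≼ z
  ≼-trans (a , b) (d , e) (g , h) (ia , ib) (id , ie) (ig , ih) p q =
    Inf-⊕-cancelˡ-≤ ie (Inf-⊕ ia ih) (Inf-⊕ ig ib)
      (≤-resp-≈ (assoc a e h ⟫ x∙yz≈y∙xz a e h) (xy∙z≈xz∙y g e b ⟫ comm (g ⊕ b) e)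
        (≤-trans (⊕-monoˡ-≤ p) (≤-resp-≈ (sym (xy∙z≈xz∙y d b h)) refl (⊕-monoˡ-≤ q))))

  ≐-trans : ∀ x y z → RadPair x → RadPair y → RadPair z → x ≐ y → y ≐ z → x ≐ z
  ≐-trans x y z rx ry rz p q = ≼-antisym x z
    (≼-trans x y z rx ry rz (≐⇒≼ x y p) (≐⇒≼ y z q))
    (≼-trans z y x rz ry rx (≐⇒≼ z y (≐-sym y z q)) (≐⇒≼ y x (≐-sym x y p)))

  +ᵖ-monoʳ-≼ : ∀ x y z → x ≼ y → z +ᵖ x ≼ z +ᵖ y
  +ᵖ-monoʳ-≼ (a , b) (d , e) (g , h) p = ≤-resp-≈
    (interchange a e g h ⟫ ∙-cong (comm a g) (comm e h))
    (interchange d b g h ⟫ ∙-cong (comm d g) (comm b h)) (⊕-monoˡ-≤ p)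

  +ᵖ-cong : ∀ x x' y y' → x ≐ x' → y ≐ y' → x +ᵖ y ≐ x' +ᵖ y'
  +ᵖ-cong (a , b) (a' , b') (d , e) (d' , e') p q =
    sym (interchange a b' d e') ⟫ ∙-cong p q ⟫ interchange a' b d' e

  +ᵖ-comm : ∀ x y → x +ᵖ y ≐ y +ᵖ x
  +ᵖ-comm (a , b) (d , e) = ≈₂⇒≐ _ _ (comm a d , comm b e)

  +ᵖ-assoc : ∀ x y z → (x +ᵖ y) +ᵖ z ≐ x +ᵖ (y +ᵖ z)
  +ᵖ-assoc (a , b) (d , e) (g , h) = ≈₂⇒≐ _ _ (assoc a d g , assoc b e h)

  +ᵖ-identityˡ : ∀ x → 0ᵖ +ᵖ x ≐ x
  +ᵖ-identityˡ (a , b) = ≈₂⇒≐ _ _ (identityˡ a , identityˡ b)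

  +ᵖ-inverseʳ : ∀ x → x +ᵖ negᵖ x ≐ 0ᵖ
  +ᵖ-inverseʳ (a , b) = identityʳ _ ⟫ comm a b ⟫ sym (identityˡ _)

  x+ᵖ[negᵖx+ᵖy]≐y : ∀ x y → x +ᵖ (negᵖ x +ᵖ y) ≐ y
  x+ᵖ[negᵖx+ᵖy]≐y (a , b) (d , e) =
    prove 4 ((x ⊕' (y ⊕' u)) ⊕' v) (u ⊕' (y ⊕' (x ⊕' v))) (a ∷ b ∷ d ∷ e ∷ [])
    where
    open ⊕-Solver renaming (_⊕_ to _⊕'_)
    x = var Fin.zero
    y = var (Fin.suc Fin.zero)
    u = var (Fin.suc (Fin.suc Fin.zero))
    v = var (Fin.suc (Fin.suc (Fin.suc Fin.zero)))

  y≐negᵖx+ᵖ[x+ᵖy] : ∀ x y → y ≐ negᵖ x +ᵖ (x +ᵖ y)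
  y≐negᵖx+ᵖ[x+ᵖy] (a , b) (d , e) =
    prove 4 (u ⊕' (x ⊕' (y ⊕' v))) ((y ⊕' (x ⊕' u)) ⊕' v) (a ∷ b ∷ d ∷ e ∷ [])
    where
    open ⊕-Solver renaming (_⊕_ to _⊕'_)
    x = var Fin.zero
    y = var (Fin.suc Fin.zero)
    u = var (Fin.suc (Fin.suc Fin.zero))
    v = var (Fin.suc (Fin.suc (Fin.suc Fin.zero)))

  x≼x∨ᵖy : ∀ x y → x ≼ x ∨ᵖ y
  x≼x∨ᵖy (a , b) (d , e) = ≤-resp-≈ (sym (∙-congˡ (comm b e) ⟫ sym (assoc a e b))) refl (⊕-monoˡ-≤ x≤x∨y)

  y≼x∨ᵖy : ∀ x y → y ≼ x ∨ᵖ y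
  y≼x∨ᵖy (a , b) (d , e) = ≤-resp-≈ (assoc d b e) refl (⊕-monoˡ-≤ y≤x∨y)

  -- Needs translation invariance of ∨, which holds on the radical only.
  ∨ᵖ-least : ∀ x y z → RadPair x → RadPair y → RadPair z → x ≼ z → y ≼ z → x ∨ᵖ y ≼ z
  ∨ᵖ-least (a , b) (d , e) (g , h) (ia , ib) (id , ie) (ig , ih) p q =
    ≤-resp-≈ (sym (comm _ h ⟫ Inf-⊕-distribˡ-∨ ih (Inf-⊕ ia ie) (Inf-⊕ id ib))) refl
      (∨-least (≤-resp-≈ (xy∙z≈xz∙y a h e ⟫ comm _ h) (assoc g b e) (⊕-monoˡ-≤ p))
               (≤-resp-≈ (xy∙z≈xz∙y d h b ⟫ comm _ h) (xy∙z≈xz∙y g e b ⟫ assoc g b e) (⊕-monoˡ-≤ q)))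

  ≐⇒⊖≈ : ∀ {a b d e} → Inf a → Inf b → Inf d → Inf e → (a , b) ≐ (d , e) → a ⊖ b ≈ d ⊖ e
  ≐⇒⊖≈ {a} {b} {d} {e} ia ib id ie p =
    Inf-⊕-cancelˡ (Inf-⊕ ib ie) (Inf-⊖ ia) (Inf-⊖ id) ([b⊕e]⊕[a⊖b] ⟫ sym [b⊕e]⊕[d⊖e])
    where
    [b⊕e]⊕[a⊖b] : (b ⊕ e) ⊕ (a ⊖ b) ≈ (d ⊕ b) ∨ (b ⊕ e)
    [b⊕e]⊕[a⊖b] = comm _ _ ⟫ sym (assoc _ b e) ⟫ comm _ e ⟫ Inf-⊕-distribˡ-∨ ie ia ib
      ⟫ ∨-cong (comm e a ⟫ p) (comm e b)
    [b⊕e]⊕[d⊖e] : (b ⊕ e) ⊕ (d ⊖ e) ≈ (d ⊕ b) ∨ (b ⊕ e)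
    [b⊕e]⊕[d⊖e] = ∙-congʳ (comm b e) ⟫ comm _ _ ⟫ sym (assoc _ e b) ⟫ comm _ b ⟫ Inf-⊕-distribˡ-∨ ib id ie
      ⟫ ∨-cong (comm b d) refl

  ∨ᵖ-idem : ∀ x → RadPair x → x ∨ᵖ x ≐ x
  ∨ᵖ-idem x rx = ≼-antisym (x ∨ᵖ x) x (∨ᵖ-least x x x rx rx rx (≼-refl x) (≼-refl x)) (x≼x∨ᵖy x x)

  ∨ᵖ-comm : ∀ x y → RadPair x → RadPair y → x ∨ᵖ y ≐ y ∨ᵖ x
  ∨ᵖ-comm x y rx ry = ≼-antisym (x ∨ᵖ y) (y ∨ᵖ x)
    (∨ᵖ-least x y (y ∨ᵖ x) rx ry (RadPair-∨ᵖ y x ry rx) (y≼x∨ᵖy y x) (x≼x∨ᵖy y x))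
    (∨ᵖ-least y x (x ∨ᵖ y) ry rx (RadPair-∨ᵖ x y rx ry) (y≼x∨ᵖy x y) (x≼x∨ᵖy x y))

  ∨ᵖ-assoc : ∀ x y z → RadPair x → RadPair y → RadPair z → (x ∨ᵖ y) ∨ᵖ z ≐ x ∨ᵖ (y ∨ᵖ z)
  ∨ᵖ-assoc x y z rx ry rz = ≼-antisym [xy]z x[yz]
    (∨ᵖ-least (x ∨ᵖ y) z x[yz] rxy rz r[yz]
      (∨ᵖ-least x y x[yz] rx ry r[yz] (x≼x∨ᵖy x (y ∨ᵖ z))
        (≼-trans y (y ∨ᵖ z) x[yz] ry ryz r[yz] (x≼x∨ᵖy y z) (y≼x∨ᵖy x (y ∨ᵖ z))))
      (≼-trans z (y ∨ᵖ z) x[yz] rz ryz r[yz] (y≼x∨ᵖy y z) (y≼x∨ᵖy x (y ∨ᵖ z))))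
    (∨ᵖ-least x (y ∨ᵖ z) [xy]z rx ryz r[xy]
      (≼-trans x (x ∨ᵖ y) [xy]z rx rxy r[xy] (x≼x∨ᵖy x y) (x≼x∨ᵖy (x ∨ᵖ y) z))
      (∨ᵖ-least y z [xy]z ry rz r[xy]
        (≼-trans y (x ∨ᵖ y) [xy]z ry rxy r[xy] (y≼x∨ᵖy x y) (x≼x∨ᵖy (x ∨ᵖ y) z))
        (y≼x∨ᵖy (x ∨ᵖ y) z)))
    where
    [xy]z = (x ∨ᵖ y) ∨ᵖ z
    x[yz] = x ∨ᵖ (y ∨ᵖ z)
    rxy   = RadPair-∨ᵖ x y rx ry
    ryz   = RadPair-∨ᵖ y z ry rz
    r[xy] = RadPair-∨ᵖ (x ∨ᵖ y) z rxy rz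
    r[yz] = RadPair-∨ᵖ x (y ∨ᵖ z) rx ryz

  ∨ᵖ-cong : ∀ x x' y y' → RadPair x → RadPair x' → RadPair y → RadPair y' →
            x ≐ x' → y ≐ y' → x ∨ᵖ y ≐ x' ∨ᵖ y'
  ∨ᵖ-cong x x' y y' rx rx' ry ry' p q = ≼-antisym (x ∨ᵖ y) (x' ∨ᵖ y')
    (∨ᵖ-least x y j' rx ry rj' (≼-trans x x' j' rx rx' rj' (≐⇒≼ x x' p) (x≼x∨ᵖy x' y'))
                               (≼-trans y y' j' ry ry' rj' (≐⇒≼ y y' q) (y≼x∨ᵖy x' y')))
    (∨ᵖ-least x' y' j rx' ry' rj (≼-trans x' x j rx' rx rj (≐⇒≼ x' x (≐-sym x x' p)) (x≼x∨ᵖy x y))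
                                 (≼-trans y' y j ry' ry rj (≐⇒≼ y' y (≐-sym y y' q)) (y≼x∨ᵖy x y)))
    where
    j  = x ∨ᵖ y
    j' = x' ∨ᵖ y'
    rj  = RadPair-∨ᵖ x y rx ry
    rj' = RadPair-∨ᵖ x' y' rx' ry'

  -- z +ᵖ_ is an order isomorphism with inverse negᵖ z +ᵖ_, so it preserves joins.
  +ᵖ-distribˡ-∨ᵖ : ∀ z x y → RadPair z → RadPair x → RadPair y → z +ᵖ (x ∨ᵖ y) ≐ (z +ᵖ x) ∨ᵖ (z +ᵖ y)
  +ᵖ-distribˡ-∨ᵖ z x y rz rx ry = ≼-antisym k j k≼j
    (∨ᵖ-least (z +ᵖ x) (z +ᵖ y) k rzx rzy rk
      (+ᵖ-monoʳ-≼ x (x ∨ᵖ y) z (x≼x∨ᵖy x y)) (+ᵖ-monoʳ-≼ y (x ∨ᵖ y) z (y≼x∨ᵖy x y)))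
    where
    z' = negᵖ z
    rz' = RadPair-negᵖ z rz
    rzx = RadPair-+ᵖ z x rz rx
    rzy = RadPair-+ᵖ z y rz ry
    j = (z +ᵖ x) ∨ᵖ (z +ᵖ y)
    k = z +ᵖ (x ∨ᵖ y)
    rj = RadPair-∨ᵖ (z +ᵖ x) (z +ᵖ y) rzx rzy
    rk = RadPair-+ᵖ z (x ∨ᵖ y) rz (RadPair-∨ᵖ x y rx ry)
    rz'j = RadPair-+ᵖ z' j rz' rj
    x≼z'+ᵖj : x ≼ z' +ᵖ j
    x≼z'+ᵖj = ≼-trans x (z' +ᵖ (z +ᵖ x)) (z' +ᵖ j) rx (RadPair-+ᵖ z' _ rz' rzx) rz'j
      (≐⇒≼ x _ (y≐negᵖx+ᵖ[x+ᵖy] z x)) (+ᵖ-monoʳ-≼ (z +ᵖ x) j z' (x≼x∨ᵖy (z +ᵖ x) (z +ᵖ y)))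
    y≼z'+ᵖj : y ≼ z' +ᵖ j
    y≼z'+ᵖj = ≼-trans y (z' +ᵖ (z +ᵖ y)) (z' +ᵖ j) ry (RadPair-+ᵖ z' _ rz' rzy) rz'j
      (≐⇒≼ y _ (y≐negᵖx+ᵖ[x+ᵖy] z y)) (+ᵖ-monoʳ-≼ (z +ᵖ y) j z' (y≼x∨ᵖy (z +ᵖ x) (z +ᵖ y)))
    k≼j : k ≼ j
    k≼j = ≼-trans k (z +ᵖ (z' +ᵖ j)) j rk (RadPair-+ᵖ z _ rz rz'j) rj
      (+ᵖ-monoʳ-≼ (x ∨ᵖ y) (z' +ᵖ j) z (∨ᵖ-least x y (z' +ᵖ j) rx ry rz'j x≼z'+ᵖj y≼z'+ᵖj))
      (≐⇒≼ _ j (x+ᵖ[negᵖx+ᵖy]≐y z j))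

module SemifieldOf {c ℓ} (PA : PerfectMVAlgebra c ℓ) where
  open RadicalDifferences PA public

  -- Arbitrary pairs are admitted and read through rad₂, which avoids a subtype of radical pairs.
  rad₂ : Pair → Pair
  rad₂ (a , b) = rad a , rad b

  RadPair-rad₂ : ∀ p → RadPair (rad₂ p)
  RadPair-rad₂ (a , b) = Inf-rad a , Inf-rad b

  rad₂-RadPair : ∀ x → RadPair x → rad₂ x ≈₂ x
  rad₂-RadPair (a , b) (ia , ib) = rad-Inf ia , rad-Inf ib

  rad₂-cong : ∀ {x y} → x ≈₂ y → rad₂ x ≈₂ rad₂ y
  rad₂-cong (p , q) = rad-cong p , rad-cong q

  rad₂-0ᵖ : rad₂ 0ᵖ ≈₂ 0ᵖ
  rad₂-0ᵖ = rad₂-RadPair 0ᵖ RadPair-0ᵖ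

  infix 4 _≐ʳ_
  _≐ʳ_ : Pair → Pair → Set ℓ
  p ≐ʳ q = rad₂ p ≐ rad₂ q

  ≈₂⇒≐ʳ : ∀ {x y} → x ≈₂ y → x ≐ʳ y
  ≈₂⇒≐ʳ {x} {y} e = ≈₂⇒≐ (rad₂ x) (rad₂ y) (rad₂-cong e)

  infixl 6 _+ʳ_
  _+ʳ_ : Pair → Pair → Pair
  p +ʳ q = rad₂ p +ᵖ rad₂ q

  infixl 5 _∨ʳ_
  _∨ʳ_ : Pair → Pair → Pair
  p ∨ʳ q = rad₂ p ∨ᵖ rad₂ q

  rad₂-+ʳ : ∀ p q → rad₂ (p +ʳ q) ≈₂ rad₂ p +ᵖ rad₂ q
  rad₂-+ʳ p q = rad₂-RadPair _ (RadPair-+ᵖ (rad₂ p) (rad₂ q) (RadPair-rad₂ p) (RadPair-rad₂ q))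

  rad₂-∨ʳ : ∀ p q → rad₂ (p ∨ʳ q) ≈₂ rad₂ p ∨ᵖ rad₂ q
  rad₂-∨ʳ p q = rad₂-RadPair _ (RadPair-∨ᵖ (rad₂ p) (rad₂ q) (RadPair-rad₂ p) (RadPair-rad₂ q))

  ≐ʳ-intro : ∀ p q {x y} → rad₂ p ≈₂ x → rad₂ q ≈₂ y → x ≐ y → p ≐ʳ q
  ≐ʳ-intro p q e₁ e₂ = ≐-resp-≈₂ (≈₂-sym e₁) (≈₂-sym e₂)

  ≐ʳ-trans : ∀ p q s → p ≐ʳ q → q ≐ʳ s → p ≐ʳ s
  ≐ʳ-trans p q s = ≐-trans (rad₂ p) (rad₂ q) (rad₂ s) (RadPair-rad₂ p) (RadPair-rad₂ q) (RadPair-rad₂ s)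

  +ʳ-cong : ∀ p p' q q' → p ≐ʳ p' → q ≐ʳ q' → p +ʳ q ≐ʳ p' +ʳ q'
  +ʳ-cong p p' q q' e f = ≐ʳ-intro (p +ʳ q) (p' +ʳ q') (rad₂-+ʳ p q) (rad₂-+ʳ p' q')
    (+ᵖ-cong (rad₂ p) (rad₂ p') (rad₂ q) (rad₂ q') e f)

  ∨ʳ-cong : ∀ p p' q q' → p ≐ʳ p' → q ≐ʳ q' → p ∨ʳ q ≐ʳ p' ∨ʳ q'
  ∨ʳ-cong p p' q q' e f = ≐ʳ-intro (p ∨ʳ q) (p' ∨ʳ q') (rad₂-∨ʳ p q) (rad₂-∨ʳ p' q')
    (∨ᵖ-cong (rad₂ p) (rad₂ p') (rad₂ q) (rad₂ q')
             (RadPair-rad₂ p) (RadPair-rad₂ p') (RadPair-rad₂ q) (RadPair-rad₂ q') e f)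

  ∨ʳ-assoc : ∀ p q s → (p ∨ʳ q) ∨ʳ s ≐ʳ p ∨ʳ (q ∨ʳ s)
  ∨ʳ-assoc p q s = ≐ʳ-intro ((p ∨ʳ q) ∨ʳ s) (p ∨ʳ (q ∨ʳ s))
    (≈₂-trans (rad₂-∨ʳ (p ∨ʳ q) s) (∨ᵖ-cong₂ (rad₂-∨ʳ p q) ≈₂-refl))
    (≈₂-trans (rad₂-∨ʳ p (q ∨ʳ s)) (∨ᵖ-cong₂ ≈₂-refl (rad₂-∨ʳ q s)))
    (∨ᵖ-assoc (rad₂ p) (rad₂ q) (rad₂ s) (RadPair-rad₂ p) (RadPair-rad₂ q) (RadPair-rad₂ s))

  ∨ʳ-comm : ∀ p q → p ∨ʳ q ≐ʳ q ∨ʳ p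
  ∨ʳ-comm p q = ≐ʳ-intro (p ∨ʳ q) (q ∨ʳ p) (rad₂-∨ʳ p q) (rad₂-∨ʳ q p)
    (∨ᵖ-comm (rad₂ p) (rad₂ q) (RadPair-rad₂ p) (RadPair-rad₂ q))

  ∨ʳ-idem : ∀ p → p ∨ʳ p ≐ʳ p
  ∨ʳ-idem p = ≐ʳ-intro (p ∨ʳ p) p (rad₂-∨ʳ p p) ≈₂-refl (∨ᵖ-idem (rad₂ p) (RadPair-rad₂ p))

  +ʳ-assoc : ∀ p q s → (p +ʳ q) +ʳ s ≐ʳ p +ʳ (q +ʳ s)
  +ʳ-assoc p q s = ≐ʳ-intro ((p +ʳ q) +ʳ s) (p +ʳ (q +ʳ s))
    (≈₂-trans (rad₂-+ʳ (p +ʳ q) s) (+ᵖ-cong₂ (rad₂-+ʳ p q) ≈₂-refl))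
    (≈₂-trans (rad₂-+ʳ p (q +ʳ s)) (+ᵖ-cong₂ ≈₂-refl (rad₂-+ʳ q s)))
    (+ᵖ-assoc (rad₂ p) (rad₂ q) (rad₂ s))

  +ʳ-comm : ∀ p q → p +ʳ q ≐ʳ q +ʳ p
  +ʳ-comm p q = ≐ʳ-intro (p +ʳ q) (q +ʳ p) (rad₂-+ʳ p q) (rad₂-+ʳ q p) (+ᵖ-comm (rad₂ p) (rad₂ q))

  +ʳ-identityˡ : ∀ p → 0ᵖ +ʳ p ≐ʳ p
  +ʳ-identityˡ p = ≐ʳ-intro (0ᵖ +ʳ p) p (≈₂-trans (rad₂-+ʳ 0ᵖ p) (+ᵖ-cong₂ rad₂-0ᵖ ≈₂-refl)) ≈₂-refl
    (+ᵖ-identityˡ (rad₂ p))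

  +ʳ-inverseʳ : ∀ p → p +ʳ negᵖ p ≐ʳ 0ᵖ
  +ʳ-inverseʳ p = ≐ʳ-intro (p +ʳ negᵖ p) 0ᵖ (rad₂-+ʳ p (negᵖ p)) rad₂-0ᵖ (+ᵖ-inverseʳ (rad₂ p))

  +ʳ-distribʳ-∨ʳ : ∀ p q s → (q ∨ʳ s) +ʳ p ≐ʳ (q +ʳ p) ∨ʳ (s +ʳ p)
  +ʳ-distribʳ-∨ʳ p q s = ≐ʳ-intro ((q ∨ʳ s) +ʳ p) ((q +ʳ p) ∨ʳ (s +ʳ p))
    (≈₂-trans (rad₂-+ʳ (q ∨ʳ s) p) (+ᵖ-cong₂ (rad₂-∨ʳ q s) ≈₂-refl))
    (≈₂-trans (rad₂-∨ʳ (q +ʳ p) (s +ʳ p)) (∨ᵖ-cong₂ (rad₂-+ʳ q p) (rad₂-+ʳ s p)))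
    (≐-trans ((Q ∨ᵖ S) +ᵖ P) (P +ᵖ (Q ∨ᵖ S)) ((Q +ᵖ P) ∨ᵖ (S +ᵖ P))
      (RadPair-+ᵖ _ _ rQS rP) (RadPair-+ᵖ _ _ rP rQS) rQPSP
      (+ᵖ-comm (Q ∨ᵖ S) P)
      (≐-trans (P +ᵖ (Q ∨ᵖ S)) ((P +ᵖ Q) ∨ᵖ (P +ᵖ S)) ((Q +ᵖ P) ∨ᵖ (S +ᵖ P))
        (RadPair-+ᵖ _ _ rP rQS) rPQPS rQPSP
        (+ᵖ-distribˡ-∨ᵖ P Q S rP rQ rS)
        (∨ᵖ-cong (P +ᵖ Q) (Q +ᵖ P) (P +ᵖ S) (S +ᵖ P)
          (RadPair-+ᵖ _ _ rP rQ) (RadPair-+ᵖ _ _ rQ rP) (RadPair-+ᵖ _ _ rP rS) (RadPair-+ᵖ _ _ rS rP)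
          (+ᵖ-comm P Q) (+ᵖ-comm P S))))
    where
    P = rad₂ p
    Q = rad₂ q
    S = rad₂ s
    rP = RadPair-rad₂ p
    rQ = RadPair-rad₂ q
    rS = RadPair-rad₂ s
    rQS = RadPair-∨ᵖ Q S rQ rS
    rQPSP = RadPair-∨ᵖ (Q +ᵖ P) (S +ᵖ P) (RadPair-+ᵖ _ _ rQ rP) (RadPair-+ᵖ _ _ rS rP)
    rPQPS = RadPair-∨ᵖ (P +ᵖ Q) (P +ᵖ S) (RadPair-+ᵖ _ _ rP rQ) (RadPair-+ᵖ _ _ rP rS)

  Element : Set c
  Element = Maybe Pair

  EqElement : Element → Element → Set ℓ
  EqElement nothing  nothing  = ⊤
  EqElement nothing  (just _) = Trivial
  EqElement (just _) nothing  = Trivial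
  EqElement (just p) (just q) = p ≐ʳ q

  -- A record rather than EqElement itself, so that both sides can be inferred from a proof.
  infix 4 _≈S_
  record _≈S_ (x y : Element) : Set ℓ where
    constructor ⟨_⟩
    field unwrap : EqElement x y

  ≈S-refl : ∀ {x} → x ≈S x
  ≈S-refl {nothing} = ⟨ tt ⟩
  ≈S-refl {just p}  = ⟨ refl ⟩

  ≈S-sym : ∀ {x y} → x ≈S y → y ≈S x
  ≈S-sym {nothing} {nothing} e        = e
  ≈S-sym {nothing} {just _}  ⟨ t ⟩ = ⟨ t ⟩
  ≈S-sym {just _}  {nothing} ⟨ t ⟩ = ⟨ t ⟩
  ≈S-sym {just _}  {just _}  ⟨ e ⟩ = ⟨ sym e ⟩

  trivial⇒≈S : Trivial → ∀ x y → x ≈S y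
  trivial⇒≈S t nothing  nothing  = ⟨ tt ⟩
  trivial⇒≈S t nothing  (just _) = ⟨ t ⟩
  trivial⇒≈S t (just _) nothing  = ⟨ t ⟩
  trivial⇒≈S t (just _) (just _) = ⟨ trivial⇒≈ t _ _ ⟩

  ≈S-trans : ∀ {x y z} → x ≈S y → y ≈S z → x ≈S z
  ≈S-trans {nothing} {nothing} f         g = g
  ≈S-trans {just p}  {just q}  {just s}  ⟨ e ⟩ ⟨ f ⟩ = ⟨ ≐ʳ-trans p q s e f ⟩
  ≈S-trans {just p}  {just q}  {nothing} f         ⟨ t ⟩ = ⟨ t ⟩
  ≈S-trans {nothing} {just q}  {z}       ⟨ t ⟩ g = trivial⇒≈S t nothing z
  ≈S-trans {just p}  {nothing} {z}       ⟨ t ⟩ g = trivial⇒≈S t (just p) z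

  map-resp : ∀ {X : Set c} {f g : X → Pair} → (∀ p → f p ≈₂ g p) → ∀ s → Maybe.map f s ≈S Maybe.map g s
  map-resp eq nothing  = ⟨ tt ⟩
  map-resp eq (just p) = ⟨ ≈₂⇒≐ʳ (eq p) ⟩

  map-∘ : ∀ {X Y : Set c} (f : X → Y) (g : Y → Pair) s →
          Maybe.map (g ∘ f) s ≈S Maybe.map g (Maybe.map f s)
  map-∘ f g nothing  = ⟨ tt ⟩
  map-∘ f g (just p) = ≈S-refl

  map-identity : ∀ {f : Pair → Pair} → (∀ p → f p ≈₂ p) → ∀ s → Maybe.map f s ≈S s
  map-identity eq nothing  = ⟨ tt ⟩
  map-identity eq (just p) = ⟨ ≈₂⇒≐ʳ (eq p) ⟩

  infixl 6 _+S_
  _+S_ : Element → Element → Element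
  nothing  +S y        = y
  just p   +S nothing  = just p
  just p   +S just q   = just (p ∨ʳ q)

  infixl 7 _*S_
  _*S_ : Element → Element → Element
  nothing  *S y        = nothing
  just p   *S nothing  = nothing
  just p   *S just q   = just (p +ʳ q)

  0S : Element
  0S = nothing

  1S : Element
  1S = just 0ᵖ

  +S-cong : ∀ {x x' y y'} → x ≈S x' → y ≈S y' → x +S y ≈S x' +S y'
  +S-cong {nothing} {nothing} e f = f
  +S-cong {just p} {just p'} {nothing} {nothing} e f = e
  +S-cong {just p} {just p'} {just q} {just q'} ⟨ e ⟩ ⟨ f ⟩ = ⟨ ∨ʳ-cong p p' q q' e f ⟩
  +S-cong {nothing} {just p'} {y} {y'} ⟨ t ⟩ f = trivial⇒≈S t _ _
  +S-cong {just p}  {nothing} {y} {y'} ⟨ t ⟩ f = trivial⇒≈S t _ _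
  +S-cong {just p} {just p'} {nothing} {just q'} e ⟨ t ⟩ = trivial⇒≈S t _ _
  +S-cong {just p} {just p'} {just q} {nothing}  e ⟨ t ⟩ = trivial⇒≈S t _ _

  *S-cong : ∀ {x x' y y'} → x ≈S x' → y ≈S y' → x *S y ≈S x' *S y'
  *S-cong {nothing} {nothing} e f = ⟨ tt ⟩
  *S-cong {just p} {just p'} {nothing} {nothing} e f = ⟨ tt ⟩
  *S-cong {just p} {just p'} {just q} {just q'} ⟨ e ⟩ ⟨ f ⟩ = ⟨ +ʳ-cong p p' q q' e f ⟩
  *S-cong {nothing} {just p'} {y} {y'} ⟨ t ⟩ f = trivial⇒≈S t _ _
  *S-cong {just p}  {nothing} {y} {y'} ⟨ t ⟩ f = trivial⇒≈S t _ _
  *S-cong {just p} {just p'} {nothing} {just q'} e ⟨ t ⟩ = trivial⇒≈S t _ _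
  *S-cong {just p} {just p'} {just q} {nothing}  e ⟨ t ⟩ = trivial⇒≈S t _ _

  +S-assoc : ∀ x y z → (x +S y) +S z ≈S x +S (y +S z)
  +S-assoc nothing  y        z        = ≈S-refl
  +S-assoc (just p) nothing  z        = ≈S-refl
  +S-assoc (just p) (just q) nothing  = ≈S-refl
  +S-assoc (just p) (just q) (just s) = ⟨ ∨ʳ-assoc p q s ⟩

  +S-comm : ∀ x y → x +S y ≈S y +S x
  +S-comm nothing  nothing  = ≈S-refl
  +S-comm nothing  (just q) = ≈S-refl
  +S-comm (just p) nothing  = ≈S-refl
  +S-comm (just p) (just q) = ⟨ ∨ʳ-comm p q ⟩

  +S-identityˡ : ∀ x → 0S +S x ≈S x
  +S-identityˡ x = ≈S-refl

  +S-identityʳ : ∀ x → x +S 0S ≈S x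
  +S-identityʳ nothing  = ≈S-refl
  +S-identityʳ (just p) = ≈S-refl

  +S-idem : ∀ x → x +S x ≈S x
  +S-idem nothing  = ≈S-refl
  +S-idem (just p) = ⟨ ∨ʳ-idem p ⟩

  *S-assoc : ∀ x y z → (x *S y) *S z ≈S x *S (y *S z)
  *S-assoc nothing  y        z        = ≈S-refl
  *S-assoc (just p) nothing  z        = ≈S-refl
  *S-assoc (just p) (just q) nothing  = ≈S-refl
  *S-assoc (just p) (just q) (just s) = ⟨ +ʳ-assoc p q s ⟩

  *S-comm : ∀ x y → x *S y ≈S y *S x
  *S-comm nothing  nothing  = ≈S-refl
  *S-comm nothing  (just q) = ≈S-refl
  *S-comm (just p) nothing  = ≈S-refl
  *S-comm (just p) (just q) = ⟨ +ʳ-comm p q ⟩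

  *S-identityˡ : ∀ x → 1S *S x ≈S x
  *S-identityˡ nothing  = ≈S-refl
  *S-identityˡ (just p) = ⟨ +ʳ-identityˡ p ⟩

  *S-identityʳ : ∀ x → x *S 1S ≈S x
  *S-identityʳ x = ≈S-trans (*S-comm x 1S) (*S-identityˡ x)

  *S-zeroˡ : ∀ x → 0S *S x ≈S 0S
  *S-zeroˡ x = ≈S-refl

  *S-distribʳ-+S : ∀ x y z → (y +S z) *S x ≈S (y *S x) +S (z *S x)
  *S-distribʳ-+S nothing  nothing  z        = ≈S-refl {z *S nothing}
  *S-distribʳ-+S nothing  (just q) nothing  = ≈S-refl
  *S-distribʳ-+S nothing  (just q) (just s) = ≈S-refl
  *S-distribʳ-+S (just p) nothing  z        = ≈S-refl
  *S-distribʳ-+S (just p) (just q) nothing  = ≈S-refl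
  *S-distribʳ-+S (just p) (just q) (just s) = ⟨ +ʳ-distribʳ-∨ʳ p q s ⟩

  *S-inverse : ∀ x → (x ≈S 0S → ⊥) → ∃ λ y → x *S y ≈S 1S
  *S-inverse nothing  x≉0 = ⊥-elim (x≉0 ≈S-refl)
  *S-inverse (just p) x≉0 = just (negᵖ p) , ⟨ +ʳ-inverseʳ p ⟩

  commutativeSemiring : CommutativeSemiring c ℓ
  commutativeSemiring = record
    { Carrier = Element
    ; _≈_ = _≈S_
    ; _+_ = _+S_
    ; _*_ = _*S_
    ; 0# = 0S
    ; 1# = 1S
    ; isCommutativeSemiring = isCommutativeSemiringˡ (record
      { +-isCommutativeMonoid = record
        { isMonoid = record
          { isSemigroup = record
            { isMagma = record { isEquivalence = ≈S-isEquivalence ; ∙-cong = +S-cong }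
            ; assoc = +S-assoc }
          ; identity = +S-identityˡ , +S-identityʳ }
        ; comm = +S-comm }
      ; *-isCommutativeMonoid = record
        { isMonoid = record
          { isSemigroup = record
            { isMagma = record { isEquivalence = ≈S-isEquivalence ; ∙-cong = *S-cong }
            ; assoc = *S-assoc }
          ; identity = *S-identityˡ , *S-identityʳ }
        ; comm = *S-comm }
      ; distribʳ = *S-distribʳ-+S
      ; zeroˡ = *S-zeroˡ })
    }
    where
    ≈S-isEquivalence : IsEquivalence _≈S_
    ≈S-isEquivalence = record { refl = ≈S-refl ; sym = ≈S-sym ; trans = ≈S-trans }

  idempotentSemifield : IdempotentSemifield c ℓ
  idempotentSemifield = record
    { commutativeSemiring = commutativeSemiring ; +-idem = +S-idem ; inverse = *S-inverse }

module SemifieldHomOf {c ℓ} (PA PB : PerfectMVAlgebra c ℓ)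
                      (h : MVHom (PerfectMVAlgebra.mvAlgebra PA) (PerfectMVAlgebra.mvAlgebra PB)) where
  module A = SemifieldOf PA
  module B = SemifieldOf PB
  open MVHom h renaming (cong to ⟦⟧-cong)
  open B using (_⟫_; ⟨_⟩)

  ⟦⟧-· : ∀ n x → ⟦ n A.· x ⟧ B.≈ n B.· ⟦ x ⟧
  ⟦⟧-· zero    x = 𝟘-homo
  ⟦⟧-· (suc n) x = ⊕-homo x (n A.· x) ⟫ B.∙-congˡ (⟦⟧-· n x)

  ⟦⟧-≤ : ∀ {x y} → x A.≤ y → ⟦ x ⟧ B.≤ ⟦ y ⟧
  ⟦⟧-≤ {x} (z , p) = ⟦ z ⟧ , (⟦⟧-cong p ⟫ ⊕-homo x z)

  ⟦⟧-Inf : ∀ {x} → A.Inf x → B.Inf ⟦ x ⟧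
  ⟦⟧-Inf {x} i n = B.≤-resp-≈ (⟦⟧-· (suc n) x) (¬-homo x) (⟦⟧-≤ (i n))

  ⟦⟧-CoInf : ∀ {x} → A.CoInf x → B.CoInf ⟦ x ⟧
  ⟦⟧-CoInf (y , iy , e) = ⟦ y ⟧ , ⟦⟧-Inf iy , (⟦⟧-cong e ⟫ ¬-homo y)

  ⟦⟧-Trivial : A.Trivial → B.Trivial
  ⟦⟧-Trivial t = B.sym 𝟘-homo ⟫ ⟦⟧-cong t ⟫ ¬-homo A.𝟘 ⟫ B.¬-cong 𝟘-homo

  ⟦⟧-radOf : ∀ x dx dy → ⟦ A.radOf x dx ⟧ B.≈ B.radOf ⟦ x ⟧ dy
  ⟦⟧-radOf x (inj₁ _)  (inj₁ _)  = B.refl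
  ⟦⟧-radOf x (inj₂ _)  (inj₂ _)  = ¬-homo x
  ⟦⟧-radOf x (inj₁ ix) (inj₂ cy) = B.trivial⇒≈ (B.Inf∧CoInf⇒Trivial (⟦⟧-Inf ix) cy) _ _
  ⟦⟧-radOf x (inj₂ cx) (inj₁ iy) = B.trivial⇒≈ (B.Inf∧CoInf⇒Trivial iy (⟦⟧-CoInf cx)) _ _

  ⟦⟧-rad : ∀ x → ⟦ A.rad x ⟧ B.≈ B.rad ⟦ x ⟧
  ⟦⟧-rad x = ⟦⟧-radOf x (PerfectMVAlgebra.perfect PA x) (PerfectMVAlgebra.perfect PB ⟦ x ⟧)

  ⟦⟧-⊖ : ∀ x y → ⟦ x A.⊖ y ⟧ B.≈ ⟦ x ⟧ B.⊖ ⟦ y ⟧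
  ⟦⟧-⊖ x y = ¬-homo _ ⟫ B.¬-cong (⊕-homo (A.¬ x) y ⟫ B.∙-congʳ (¬-homo x))

  ⟦⟧-∨ : ∀ x y → ⟦ x A.∨ y ⟧ B.≈ ⟦ x ⟧ B.∨ ⟦ y ⟧
  ⟦⟧-∨ x y = ⊕-homo _ y ⟫ B.∙-congʳ (⟦⟧-⊖ x y)

  ⟦⟧₂ : A.Pair → B.Pair
  ⟦⟧₂ (a , b) = ⟦ a ⟧ , ⟦ b ⟧

  ⟦⟧₂-rad₂ : ∀ p → ⟦⟧₂ (A.rad₂ p) B.≈₂ B.rad₂ (⟦⟧₂ p)
  ⟦⟧₂-rad₂ (a , b) = ⟦⟧-rad a , ⟦⟧-rad b

  ⟦⟧₂-≐ : ∀ x y → x A.≐ y → ⟦⟧₂ x B.≐ ⟦⟧₂ y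
  ⟦⟧₂-≐ (a , b) (d , e) p = B.sym (⊕-homo a e) ⟫ ⟦⟧-cong p ⟫ ⊕-homo d b

  ⟦⟧₂-+ᵖ : ∀ x y → ⟦⟧₂ (x A.+ᵖ y) B.≈₂ ⟦⟧₂ x B.+ᵖ ⟦⟧₂ y
  ⟦⟧₂-+ᵖ (a , b) (d , e) = ⊕-homo a d , ⊕-homo b e

  ⟦⟧₂-∨ᵖ : ∀ x y → ⟦⟧₂ (x A.∨ᵖ y) B.≈₂ ⟦⟧₂ x B.∨ᵖ ⟦⟧₂ y
  ⟦⟧₂-∨ᵖ (a , b) (d , e) = (⟦⟧-∨ _ _ ⟫ B.∨-cong (⊕-homo a e) (⊕-homo d b)) , ⊕-homo b e

  ⟦⟧₂-≐ʳ : ∀ p q → p A.≐ʳ q → ⟦⟧₂ p B.≐ʳ ⟦⟧₂ q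
  ⟦⟧₂-≐ʳ p q e = B.≐-resp-≈₂ (⟦⟧₂-rad₂ p) (⟦⟧₂-rad₂ q) (⟦⟧₂-≐ (A.rad₂ p) (A.rad₂ q) e)

  ⟦⟧S : A.Element → B.Element
  ⟦⟧S = Maybe.map ⟦⟧₂

  ⟦⟧S-cong : ∀ {x y} → x A.≈S y → ⟦⟧S x B.≈S ⟦⟧S y
  ⟦⟧S-cong {nothing} {nothing} _     = ⟨ tt ⟩
  ⟦⟧S-cong {nothing} {just _}  ⟨ t ⟩ = ⟨ ⟦⟧-Trivial t ⟩
  ⟦⟧S-cong {just _}  {nothing} ⟨ t ⟩ = ⟨ ⟦⟧-Trivial t ⟩
  ⟦⟧S-cong {just p}  {just q}  ⟨ e ⟩ = ⟨ ⟦⟧₂-≐ʳ p q e ⟩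

  ⟦⟧S-+S : ∀ x y → ⟦⟧S (x A.+S y) B.≈S ⟦⟧S x B.+S ⟦⟧S y
  ⟦⟧S-+S nothing  y        = B.≈S-refl
  ⟦⟧S-+S (just p) nothing  = B.≈S-refl
  ⟦⟧S-+S (just p) (just q) =
    ⟨ B.≈₂⇒≐ʳ (B.≈₂-trans (⟦⟧₂-∨ᵖ (A.rad₂ p) (A.rad₂ q)) (B.∨ᵖ-cong₂ (⟦⟧₂-rad₂ p) (⟦⟧₂-rad₂ q))) ⟩

  ⟦⟧S-*S : ∀ x y → ⟦⟧S (x A.*S y) B.≈S ⟦⟧S x B.*S ⟦⟧S y
  ⟦⟧S-*S nothing  y        = B.≈S-refl
  ⟦⟧S-*S (just p) nothing  = B.≈S-refl
  ⟦⟧S-*S (just p) (just q) =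
    ⟨ B.≈₂⇒≐ʳ (B.≈₂-trans (⟦⟧₂-+ᵖ (A.rad₂ p) (A.rad₂ q)) (B.+ᵖ-cong₂ (⟦⟧₂-rad₂ p) (⟦⟧₂-rad₂ q))) ⟩

  ⟦⟧S-1S : ⟦⟧S A.1S B.≈S B.1S
  ⟦⟧S-1S = ⟨ B.≈₂⇒≐ʳ (𝟘-homo , 𝟘-homo) ⟩

  semiringHom : SemiringHom A.idempotentSemifield B.idempotentSemifield
  semiringHom = ⟦⟧S , record
    { isNearSemiringHomomorphism = record
      { +-isMonoidHomomorphism = record
        { isMagmaHomomorphism = record
          { isRelHomomorphism = record { cong = ⟦⟧S-cong }
          ; homo = ⟦⟧S-+S }
        ; ε-homo = ⟨ tt ⟩ }
      ; *-homo = ⟦⟧S-*S }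
    ; 1#-homo = ⟦⟧S-1S }

module SemiringHomInverse {c ℓ} (S T : IdempotentSemifield c ℓ) (g : SemiringHom S T)
  (f : IdempotentSemifield.Carrier T → IdempotentSemifield.Carrier S)
  (f-cong : ∀ {x y} → IdempotentSemifield._≈_ T x y → IdempotentSemifield._≈_ S (f x) (f y))
  (f∘g≈id : ∀ x → IdempotentSemifield._≈_ S (f (proj₁ g x)) x)
  (g∘f≈id : ∀ y → IdempotentSemifield._≈_ T (proj₁ g (f y)) y) where
  private
    module S = IdempotentSemifield S
    module T = IdempotentSemifield T
  open SemiringMorphisms.IsSemiringHomomorphism (proj₂ g)

  f-+ : ∀ x y → f (x T.+ y) S.≈ f x S.+ f y
  f-+ x y =
    S.trans (f-cong (T.sym (T.trans (+-homo (f x) (f y)) (T.+-cong (g∘f≈id x) (g∘f≈id y))))) (f∘g≈id _)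

  f-* : ∀ x y → f (x T.* y) S.≈ f x S.* f y
  f-* x y =
    S.trans (f-cong (T.sym (T.trans (*-homo (f x) (f y)) (T.*-cong (g∘f≈id x) (g∘f≈id y))))) (f∘g≈id _)

  semiringHom : SemiringHom T S
  semiringHom = f , record
    { isNearSemiringHomomorphism = record
      { +-isMonoidHomomorphism = record
        { isMagmaHomomorphism = record
          { isRelHomomorphism = record { cong = f-cong }
          ; homo = f-+ }
        ; ε-homo = S.trans (f-cong (T.sym 0#-homo)) (f∘g≈id _) }
      ; *-homo = f-* }
    ; 1#-homo = S.trans (f-cong (T.sym 1#-homo)) (f∘g≈id _) }

module MVHomInverse {c ℓ} (A B : MVAlgebra c ℓ) (g : MVHom A B)
  (f : MVAlgebra.Carrier B → MVAlgebra.Carrier A)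
  (f-cong : ∀ {x y} → MVAlgebra._≈_ B x y → MVAlgebra._≈_ A (f x) (f y))
  (f∘g≈id : ∀ x → MVAlgebra._≈_ A (f (MVHom.⟦_⟧ g x)) x)
  (g∘f≈id : ∀ y → MVAlgebra._≈_ B (MVHom.⟦_⟧ g (f y)) y) where
  private
    module A = MVAlgebra A
    module B = MVAlgebra B
  open MVHom g

  mvHom : MVHom B A
  mvHom = record
    { ⟦_⟧ = f
    ; cong = f-cong
    ; ⊕-homo = λ x y →
        A.trans (f-cong (B.sym (B.trans (⊕-homo (f x) (f y)) (B.∙-cong (g∘f≈id x) (g∘f≈id y))))) (f∘g≈id _)
    ; ¬-homo = λ x → A.trans (f-cong (B.sym (B.trans (¬-homo (f x)) (B.¬-cong (g∘f≈id x))))) (f∘g≈id _)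
    ; 𝟘-homo = A.trans (f-cong (B.sym 𝟘-homo)) (f∘g≈id _)
    }

module SemifieldUnit {c ℓ} (F : IdempotentSemifield c ℓ) (em : ExcludedMiddle (c ⊔ ℓ)) where
  open IdempotentSemifieldProperties F em
  open PerfectMVAlgebraOf F em
    using ( _≈M_; _⊕M_; value; same-flag; trivial⇒≈M; ≈M-flags-≢⇒Trivial; ≈M-refl; ≈M-sym; ≈M-trans
          ; ⊕M-cong; perfectMVAlgebra)
  module S = SemifieldOf perfectMVAlgebra
  open S using (⟨_⟩)

  rad≈false : ∀ x → S.rad x ≈M (false , proj₂ x)
  rad≈false (false , a) = ≈M-refl
  rad≈false (true , a)  = ≈M-refl

  1≤value : ∀ u → 1# ≤ value u
  1≤value (_ , a) = 1≤x+1 a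

  Unit-value : ∀ u → Unit (value u)
  Unit-value u = 1≤⇒Unit (1≤value u)

  value-rad⊕rad : ∀ u v → value (S.rad u ⊕M S.rad v) ≈ value u * value v
  value-rad⊕rad u v =
    _≈M_.values (⊕M-cong (rad≈false u) (rad≈false v)) ⟫ 1≤⇒+1≈ (1≤-* (1≤value u) (1≤value v))

  value-∨ : ∀ x y → value ((false , x) S.∨ (false , y)) ≈ (x + 1#) + (y + 1#)
  value-∨ x y =
    +-congʳ ([a*b⁻¹+1]*b≈a+b (Unit-value (false , y)) (x + 1#)) ⟫ 1≤⇒+1≈ (1≤-+ (y + 1#) (1≤x+1 x))

  -- A difference u − v of infinitesimals of M is the quotient of their values.
  fromS : S.Element → Carrier
  fromS nothing        = 0#
  fromS (just (u , v)) = value u * value v ⁻¹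

  *-cross : ∀ {a b a' b'} → Unit b → Unit b' → a * b' ≈ a' * b → a * b ⁻¹ ≈ a' * b' ⁻¹
  *-cross {a} {b} {a'} {b'} ub ub' e =
    sym (y*x*x⁻¹≈y ub' (a * b ⁻¹)) ⟫ *-congʳ (ab⁻¹b'≈ab'b⁻¹ ⟫ *-congʳ e ⟫ y*x*x⁻¹≈y ub a')
    where
    ab⁻¹b'≈ab'b⁻¹ : (a * b ⁻¹) * b' ≈ (a * b') * b ⁻¹
    ab⁻¹b'≈ab'b⁻¹ = *-assoc a (b ⁻¹) b' ⟫ *-congˡ (*-comm _ _) ⟫ sym (*-assoc a b' (b ⁻¹))

  fraction-+ : ∀ {a a' b b'} → Unit b → Unit b' → (a * b' + a' * b) * (b * b') ⁻¹ ≈ a * b ⁻¹ + a' * b' ⁻¹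
  fraction-+ {a} {a'} {b} {b'} ub ub' = distribʳ _ _ _ ⟫ +-cong
    (*-cross (Unit-* ub ub') ub (*-assoc a b' b ⟫ *-congˡ (*-comm b' b)))
    (*-cross (Unit-* ub ub') ub' (*-assoc a' b b'))

  fraction-* : ∀ {a a' b b'} → Unit b → Unit b' → (a * a') * (b * b') ⁻¹ ≈ (a * b ⁻¹) * (a' * b' ⁻¹)
  fraction-* {a} {a'} {b} {b'} ub ub' = *-congˡ (⁻¹-distrib-* ub ub') ⟫ *-interchange a a' (b ⁻¹) (b' ⁻¹)

  fromS-cong : ∀ {x y} → x S.≈S y → fromS x ≈ fromS y
  fromS-cong {nothing}      {nothing}        _     = refl
  fromS-cong {nothing}      {just _}         ⟨ t ⟩ = trivial⇒≈ (≈M-flags-≢⇒Trivial t (λ ())) _ _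
  fromS-cong {just _}       {nothing}        ⟨ t ⟩ = trivial⇒≈ (≈M-flags-≢⇒Trivial t (λ ())) _ _
  fromS-cong {just (u , v)} {just (u' , v')} ⟨ e ⟩ =
    *-cross (Unit-value v) (Unit-value v') (sym (value-rad⊕rad u v') ⟫ _≈M_.values e ⟫ value-rad⊕rad u' v)

  fromS-+ : ∀ x y → fromS (x S.+S y) ≈ fromS x + fromS y
  fromS-+ nothing        y                = sym (+-identityˡ _)
  fromS-+ (just p)       nothing          = sym (+-identityʳ _)
  fromS-+ (just (u , v)) (just (u' , v')) =
    *-cong (_≈M_.values (S.∨-cong (⊕M-cong (rad≈false u) (rad≈false v'))
                                  (⊕M-cong (rad≈false u') (rad≈false v)))
            ⟫ value-∨ _ _
            ⟫ +-cong (1≤⇒+1≈ (1≤-* (1≤value u) (1≤value v'))) (1≤⇒+1≈ (1≤-* (1≤value u') (1≤value v))))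
           (⁻¹-cong (value-rad⊕rad v v'))
    ⟫ fraction-+ (Unit-value v) (Unit-value v')

  fromS-* : ∀ x y → fromS (x S.*S y) ≈ fromS x * fromS y
  fromS-* nothing        y                = sym (zeroˡ _)
  fromS-* (just p)       nothing          = sym (zeroʳ _)
  fromS-* (just (u , v)) (just (u' , v')) =
    *-cong (value-rad⊕rad u u') (⁻¹-cong (value-rad⊕rad v v')) ⟫ fraction-* (Unit-value v) (Unit-value v')

  fromS-semiringHom : SemiringHom S.idempotentSemifield F
  fromS-semiringHom = fromS , record
    { isNearSemiringHomomorphism = record
      { +-isMonoidHomomorphism = record
        { isMagmaHomomorphism = record
          { isRelHomomorphism = record { cong = fromS-cong }
          ; homo = fromS-+ }
        ; ε-homo = refl }
      ; *-homo = fromS-* }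
    ; 1#-homo = inverseʳ (1≤⇒Unit (1≤x+1 0#)) }

  -- x = (x ∨ 1) / (x⁻¹ ∨ 1) for x ≉ 0#.
  toS : Carrier → S.Element
  toS x with em {Lift c (x ≈ 0#)}
  ... | yes _ = nothing
  ... | no _  = just ((false , x) , (false , x ⁻¹))

  toS-cong : ∀ {x y} → x ≈ y → toS x S.≈S toS y
  toS-cong {x} {y} p with em {Lift c (x ≈ 0#)} | em {Lift c (y ≈ 0#)}
  ... | yes _          | yes _          = ⟨ tt ⟩
  ... | yes (lift x≈0) | no y≉0         = ⊥-elim (y≉0 (lift (sym p ⟫ x≈0)))
  ... | no x≉0         | yes (lift y≈0) = ⊥-elim (x≉0 (lift (p ⟫ y≈0)))
  ... | no _           | no _           =
    ⟨ same-flag (+-congʳ (*-cong (+-congʳ p) (+-congʳ (⁻¹-cong (sym p))))) ⟩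

  fromS-toS : ∀ x → fromS (toS x) ≈ x
  fromS-toS x with em {Lift c (x ≈ 0#)}
  ... | yes (lift x≈0) = sym x≈0
  ... | no x≉0        = *-congʳ x+1≈x[x⁻¹+1] ⟫ y*x*x⁻¹≈y (1≤⇒Unit (1≤x+1 (x ⁻¹))) x
    where
    x+1≈x[x⁻¹+1] : x + 1# ≈ x * (x ⁻¹ + 1#)
    x+1≈x[x⁻¹+1] = sym (distribˡ x (x ⁻¹) 1# ⟫ +-cong (inverseʳ (⊥-elim ∘ x≉0 ∘ lift)) (*-identityʳ x)
                        ⟫ +-comm 1# x)

  toS-fromS : ∀ y → toS (fromS y) S.≈S y
  toS-fromS nothing with em {Lift c (0# ≈ 0#)}
  ... | yes _   = ⟨ tt ⟩
  ... | no 0≉0 = ⊥-elim (0≉0 (lift refl))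
  toS-fromS (just (u , v)) with em {Lift c (value u * value v ⁻¹ ≈ 0#)}
  ... | yes (lift z≈0) =
    ⟨ trivial⇒≈M (Unit-value u (sym (y*x⁻¹*x≈y (Unit-value v) (value u)) ⟫ *-congʳ z≈0 ⟫ zeroˡ _)) _ _ ⟩
  ... | no _ = ⟨ ≈M-trans (⊕M-cong (≈M-refl {false , z}) (rad≈false v))
                 (≈M-trans z⊕v≈u⊕z⁻¹ (≈M-sym (⊕M-cong (rad≈false u) (≈M-refl {false , z ⁻¹})))) ⟩
    where
    U = value u
    V = value v
    z = U * V ⁻¹
    z⁻¹≈U⁻¹V : z ⁻¹ ≈ U ⁻¹ * V
    z⁻¹≈U⁻¹V = ⁻¹-distrib-* (Unit-value u) (Unit-⁻¹ (Unit-value v)) ⟫ *-congˡ (⁻¹-involutive (Unit-value v))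
    U[z⁻¹+1]≈V+U : U * (z ⁻¹ + 1#) ≈ V + U
    U[z⁻¹+1]≈V+U = distribˡ U (z ⁻¹) 1# ⟫ +-cong
      (*-congˡ z⁻¹≈U⁻¹V ⟫ sym (*-assoc U (U ⁻¹) V) ⟫ *-congʳ (inverseʳ (Unit-value u)) ⟫ *-identityˡ V)
      (*-identityʳ U)
    z⊕v≈u⊕z⁻¹ : (false , z) ⊕M (false , proj₂ v) ≈M (false , proj₂ u) ⊕M (false , z ⁻¹)
    z⊕v≈u⊕z⁻¹ = same-flag (+-congʳ ([a*b⁻¹+1]*b≈a+b (Unit-value v) U ⟫ +-comm U V ⟫ sym U[z⁻¹+1]≈V+U))

  toS-semiringHom : SemiringHom F S.idempotentSemifield
  toS-semiringHom =
    SemiringHomInverse.semiringHom S.idempotentSemifield F fromS-semiringHom toS toS-cong toS-fromS fromS-toS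

module SemifieldUnitNatural {c ℓ} (F F' : IdempotentSemifield c ℓ) (em : ExcludedMiddle (c ⊔ ℓ))
                            (φ : SemiringHom F F') where
  module S = IdempotentSemifieldProperties F em
  module T = IdempotentSemifieldProperties F' em
  module U = SemifieldUnit F em
  module U' = SemifieldUnit F' em
  module Mφ = PerfectMVHomOf F F' em φ
  module SMφ = SemifieldHomOf (PerfectMVAlgebraOf.perfectMVAlgebra F em)
                              (PerfectMVAlgebraOf.perfectMVAlgebra F' em) Mφ.mvHom
  open SemiringMorphisms.IsSemiringHomomorphism (proj₂ φ)
  open T using (_⟫_)
  open U'.S using (⟨_⟩)

  f : S.Carrier → T.Carrier
  f = proj₁ φ

  toS-natural : ∀ x → U'.toS (f x) U'.S.≈S SMφ.⟦⟧S (U.toS x)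
  toS-natural x with em {Lift c (x S.≈ S.0#)} | em {Lift c (f x T.≈ T.0#)}
  ... | yes _          | yes _          = ⟨ tt ⟩
  ... | yes (lift x≈0) | no fx≉0        = ⊥-elim (fx≉0 (lift (⟦⟧-cong x≈0 ⟫ 0#-homo)))
  ... | no x≉0         | yes (lift fx≈0) = ⟨ PerfectMVAlgebraOf.trivial⇒≈M F' em 0≈1 _ _ ⟩
    where
    0≈1 : T.Trivial
    0≈1 = T.sym (T.sym 1#-homo ⟫ ⟦⟧-cong (S.sym (S.inverseʳ (⊥-elim ∘ x≉0 ∘ lift)))
      ⟫ *-homo x (x S.⁻¹) ⟫ T.*-congʳ fx≈0 ⟫ T.zeroˡ _)
  ... | no x≉0         | no _           =
    ⟨ PerfectMVAlgebraOf.same-flag F' em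
        (T.+-congʳ (T.*-congˡ (T.+-congʳ (Mφ.f-⁻¹ (⊥-elim ∘ x≉0 ∘ lift))))) ⟩

module Counit {c ℓ} (PA : PerfectMVAlgebra c ℓ) (em : ExcludedMiddle (c ⊔ ℓ)) where
  open SemifieldOf PA
  module SF = IdempotentSemifieldProperties idempotentSemifield em
  module MS = PerfectMVAlgebraOf idempotentSemifield em
  open MS using (_≈M_; _⊕M_; ¬M; same-flag; trivial⇒≈M; ≈M-flags-≢⇒Trivial)

  -- The positive part (a − b) ∨ 0 of a difference, an infinitesimal of A.
  pos : Element → Carrier
  pos nothing        = 𝟘
  pos (just (a , b)) = rad a ⊖ rad b

  Inf-pos : ∀ x → Inf (pos x)
  Inf-pos nothing        = Inf-𝟘
  Inf-pos (just (a , b)) = Inf-⊖ (Inf-rad a)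

  pos-cong : ∀ {x y} → x ≈S y → pos x ≈ pos y
  pos-cong {nothing}       {nothing}       _     = refl
  pos-cong {nothing}       {just _}        ⟨ t ⟩ = trivial⇒≈ t _ _
  pos-cong {just _}        {nothing}       ⟨ t ⟩ = trivial⇒≈ t _ _
  pos-cong {just (a , b)}  {just (d , e)}  ⟨ p ⟩ = ≐⇒⊖≈ (Inf-rad a) (Inf-rad b) (Inf-rad d) (Inf-rad e) p

  rad₂[p∨ʳ0ᵖ] : ∀ p → rad₂ (p ∨ʳ 0ᵖ) ≈₂ (proj₁ (rad₂ p) ∨ proj₂ (rad₂ p) , proj₂ (rad₂ p))
  rad₂[p∨ʳ0ᵖ] p = ≈₂-trans (rad₂-∨ʳ p 0ᵖ) (≈₂-trans (∨ᵖ-cong₂ (≈₂-refl {rad₂ p}) rad₂-0ᵖ)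
    (∨-cong (identityʳ _) (identityˡ _) , identityʳ _))

  pos-+S1S : ∀ p → pos (just p +S 1S) ≈ pos (just p)
  pos-+S1S p = ⊖-cong (proj₁ (rad₂[p∨ʳ0ᵖ] p)) (proj₂ (rad₂[p∨ʳ0ᵖ] p)) ⟫ [a∨b]⊖b≈a⊖b (Inf-rad _) (Inf-rad _)

  s+S1S≈pos : ∀ s → s +S 1S ≈S just (pos (s +S 1S) , 𝟘)
  s+S1S≈pos nothing  = ⟨ ≐ʳ-intro 0ᵖ (pos 1S , 𝟘) rad₂-0ᵖ (rad₂-RadPair _ (Inf-pos 1S , Inf-𝟘))
    (∙-congʳ (sym (x⊖x≈𝟘 (rad 𝟘)))) ⟩
  s+S1S≈pos (just p) = ⟨ ≐ʳ-intro (p ∨ʳ 0ᵖ) (pos (just p +S 1S) , 𝟘) (rad₂[p∨ʳ0ᵖ] p)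
    (rad₂-RadPair _ (Inf-pos (just p +S 1S) , Inf-𝟘)) (identityʳ _ ⟫ ∙-congʳ (sym (pos-+S1S p))) ⟩

  [e,𝟘]+S1S≈[e,𝟘] : ∀ {e} → Inf e → just (e , 𝟘) +S 1S ≈S just (e , 𝟘)
  [e,𝟘]+S1S≈[e,𝟘] {e} ie = ⟨ ≐ʳ-intro ((e , 𝟘) ∨ʳ 0ᵖ) (e , 𝟘)
    (≈₂-trans (rad₂-∨ʳ (e , 𝟘) 0ᵖ) (∨ᵖ-cong₂ (rad₂-RadPair (e , 𝟘) (ie , Inf-𝟘)) rad₂-0ᵖ))
    (rad₂-RadPair (e , 𝟘) (ie , Inf-𝟘))
    (identityʳ _ ⟫ ∨-cong (identityʳ e) (identityʳ 𝟘) ⟫ identityʳ _ ⟫ x⊖𝟘≈x e ⟫ sym (identityʳ e)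
     ⟫ ∙-congˡ (sym (identityʳ 𝟘))) ⟩

  pos[w+S1S]≈ : ∀ {w e} → Inf e → w ≈S just (e , 𝟘) → pos (w +S 1S) ≈ e
  pos[w+S1S]≈ {e = e} ie p = pos-cong (≈S-trans (+S-cong p (≈S-refl {1S})) ([e,𝟘]+S1S≈[e,𝟘] ie))
    ⟫ ⊖-cong (rad-Inf ie) (rad-Inf Inf-𝟘) ⟫ x⊖𝟘≈x e

  pos[w+S1S]≈pos : ∀ {w} p → w ≈S just p → pos (w +S 1S) ≈ pos (just p)
  pos[w+S1S]≈pos p e = pos-cong (+S-cong e (≈S-refl {1S})) ⟫ pos-+S1S p

  fromM : MS.M → Carrier
  fromM (false , s) = pos (s +S 1S)
  fromM (true , s)  = ¬ pos (s +S 1S)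

  fromM-cong : ∀ {x y} → x ≈M y → fromM x ≈ fromM y
  fromM-cong {false , _} {false , _} e = pos-cong (_≈M_.values e)
  fromM-cong {true , _}  {true , _}  e = ¬-cong (pos-cong (_≈M_.values e))
  fromM-cong {false , _} {true , _}  e = trivial⇒≈ (_≈S_.unwrap (≈M-flags-≢⇒Trivial e (λ ()))) _ _
  fromM-cong {true , _}  {false , _} e = trivial⇒≈ (_≈S_.unwrap (≈M-flags-≢⇒Trivial e (λ ()))) _ _

  [e,𝟘]*S[d,𝟘] : ∀ {e d} → Inf e → Inf d → just (e , 𝟘) *S just (d , 𝟘) ≈S just (e ⊕ d , 𝟘)
  [e,𝟘]*S[d,𝟘] {e} {d} ie id = ⟨ ≈₂⇒≐ʳ (≈₂-trans
    (+ᵖ-cong₂ (rad₂-RadPair _ (ie , Inf-𝟘)) (rad₂-RadPair _ (id , Inf-𝟘)))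
    (refl , identityʳ 𝟘)) ⟩

  [𝟘,e]≈[e,𝟘]⁻¹ : ∀ {u e} → u ≈S just (e , 𝟘) → just (𝟘 , e) ≈S u SF.⁻¹
  [𝟘,e]≈[e,𝟘]⁻¹ {e = e} u≈ = SF.*≈1⇒≈⁻¹ (≈S-trans (*S-cong u≈ ≈S-refl) ⟨ +ʳ-inverseʳ (e , 𝟘) ⟩)

  -- The case ε u ⊕ ¬ ε v, computed in the semifield as v / u.
  ¬pos[v/u+1] : ∀ {u v e d} → Inf e → Inf d → u ≈S just (e , 𝟘) → v ≈S just (d , 𝟘) →
                ¬ pos ((v *S u SF.⁻¹) +S 1S) ≈ ¬ d ⊕ e
  ¬pos[v/u+1] {e = e} {d} ie id u≈ v≈ =
    ¬-cong (pos[w+S1S]≈pos (d , e) v/u≈[d,e] ⟫ ⊖-cong (rad-Inf id) (rad-Inf ie)) ⟫ ¬¬ _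
    where
    v/u≈[d,e] = ≈S-trans (*S-cong v≈ (≈S-sym ([𝟘,e]≈[e,𝟘]⁻¹ u≈)))
      ⟨ ≈₂⇒≐ʳ (≈₂-trans (+ᵖ-cong₂ (rad₂-RadPair _ (id , Inf-𝟘)) (rad₂-RadPair _ (Inf-𝟘 , ie)))
                         (identityʳ d , identityˡ e)) ⟩

  fromM-⊕ : ∀ x y → fromM (x ⊕M y) ≈ fromM x ⊕ fromM y
  fromM-⊕ (false , s) (false , s') = pos[w+S1S]≈ (Inf-⊕ (Inf-pos (s +S 1S)) (Inf-pos (s' +S 1S)))
    (≈S-trans (*S-cong (s+S1S≈pos s) (s+S1S≈pos s')) ([e,𝟘]*S[d,𝟘] (Inf-pos (s +S 1S)) (Inf-pos (s' +S 1S))))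
  fromM-⊕ (false , s) (true , s')  =
    ¬pos[v/u+1] (Inf-pos (s +S 1S)) (Inf-pos (s' +S 1S)) (s+S1S≈pos s) (s+S1S≈pos s') ⟫ comm _ _
  fromM-⊕ (true , s)  (false , s') =
    ¬pos[v/u+1] (Inf-pos (s' +S 1S)) (Inf-pos (s +S 1S)) (s+S1S≈pos s') (s+S1S≈pos s)
  fromM-⊕ (true , s)  (true , s')  = ¬-cong (x⊖x≈𝟘 (rad 𝟘))
    ⟫ sym (≤⇒¬⊕≈𝟙 (Inf⇒≤¬Inf (Inf-pos (s +S 1S)) (Inf-pos (s' +S 1S))))

  fromM-¬ : ∀ x → fromM (¬M x) ≈ ¬ fromM x
  fromM-¬ (false , s) = refl
  fromM-¬ (true , s)  = sym (¬¬ _)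

  fromM-mvHom : MVHom MS.mvAlgebra (PerfectMVAlgebra.mvAlgebra PA)
  fromM-mvHom = record
    { ⟦_⟧ = fromM
    ; cong = fromM-cong
    ; ⊕-homo = fromM-⊕
    ; ¬-homo = fromM-¬
    ; 𝟘-homo = x⊖x≈𝟘 (rad 𝟘)
    }

  [x,𝟘]+S1S-cong : ∀ {x y} → x ≈ y → just (x , 𝟘) +S 1S ≈S just (y , 𝟘) +S 1S
  [x,𝟘]+S1S-cong {x} {y} p = +S-cong {just (x , 𝟘)} {just (y , 𝟘)} ⟨ ∙-congʳ (rad-cong p) ⟩ (≈S-refl {1S})

  toM : Carrier → MS.M
  toM x with perfect x
  ... | inj₁ _ = false , just (x , 𝟘)
  ... | inj₂ _ = true , just (¬ x , 𝟘)

  toM-cong : ∀ {x y} → x ≈ y → toM x ≈M toM y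
  toM-cong {x} {y} p with perfect x | perfect y
  ... | inj₁ _  | inj₁ _  = same-flag ([x,𝟘]+S1S-cong p)
  ... | inj₂ _  | inj₂ _  = same-flag ([x,𝟘]+S1S-cong (¬-cong p))
  ... | inj₁ ix | inj₂ cy = trivial⇒≈M ⟨ Inf∧CoInf⇒Trivial (Inf-resp p ix) cy ⟩ _ _
  ... | inj₂ cx | inj₁ iy = trivial⇒≈M ⟨ Inf∧CoInf⇒Trivial iy (CoInf-resp p cx) ⟩ _ _

  fromM-toM : ∀ x → fromM (toM x) ≈ x
  fromM-toM x with perfect x
  ... | inj₁ ix = pos[w+S1S]≈ ix ≈S-refl
  ... | inj₂ co = ¬-cong (pos[w+S1S]≈ (CoInf⇒Inf¬ co) ≈S-refl) ⟫ ¬¬ x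

  toM-fromM : ∀ y → toM (fromM y) ≈M y
  toM-fromM (false , s) with perfect (pos (s +S 1S))
  ... | inj₁ _  = same-flag (≈S-trans ([e,𝟘]+S1S≈[e,𝟘] (Inf-pos (s +S 1S))) (≈S-sym (s+S1S≈pos s)))
  ... | inj₂ co = trivial⇒≈M ⟨ Inf∧CoInf⇒Trivial (Inf-pos (s +S 1S)) co ⟩ _ _
  toM-fromM (true , s) with perfect (¬ pos (s +S 1S))
  ... | inj₂ _ = same-flag (≈S-trans ([x,𝟘]+S1S-cong (¬¬ _))
                   (≈S-trans ([e,𝟘]+S1S≈[e,𝟘] (Inf-pos (s +S 1S))) (≈S-sym (s+S1S≈pos s))))
  ... | inj₁ i = trivial⇒≈M ⟨ Inf∧CoInf⇒Trivial i (pos (s +S 1S) , Inf-pos (s +S 1S) , refl) ⟩ _ _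

  toM-mvHom : MVHom (PerfectMVAlgebra.mvAlgebra PA) MS.mvAlgebra
  toM-mvHom =
    MVHomInverse.mvHom MS.mvAlgebra (PerfectMVAlgebra.mvAlgebra PA) fromM-mvHom toM toM-cong toM-fromM fromM-toM

module CounitNatural {c ℓ} (PA PB : PerfectMVAlgebra c ℓ) (em : ExcludedMiddle (c ⊔ ℓ))
                     (h : MVHom (PerfectMVAlgebra.mvAlgebra PA) (PerfectMVAlgebra.mvAlgebra PB)) where
  module A = SemifieldOf PA
  module B = SemifieldOf PB
  module CA = Counit PA em
  module CB = Counit PB em
  module Sh = SemifieldHomOf PA PB h
  open MVHom h
  open B using (_⟫_)

  pos-⟦⟧S : ∀ w → CB.pos (Sh.⟦⟧S w) B.≈ ⟦ CA.pos w ⟧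
  pos-⟦⟧S nothing        = B.sym 𝟘-homo
  pos-⟦⟧S (just (a , b)) = B.⊖-cong (B.sym (Sh.⟦⟧-rad a)) (B.sym (Sh.⟦⟧-rad b)) ⟫ B.sym (Sh.⟦⟧-⊖ _ _)

  pos[⟦⟧S+S1S] : ∀ s → CB.pos (Sh.⟦⟧S s B.+S B.1S) B.≈ ⟦ CA.pos (s A.+S A.1S) ⟧
  pos[⟦⟧S+S1S] s =
    CB.pos-cong (B.≈S-sym (B.≈S-trans (Sh.⟦⟧S-+S s A.1S) (B.+S-cong (B.≈S-refl {Sh.⟦⟧S s}) Sh.⟦⟧S-1S)))
    ⟫ pos-⟦⟧S (s A.+S A.1S)

  fromM-natural : ∀ x → CB.fromM (proj₁ x , Sh.⟦⟧S (proj₂ x)) B.≈ ⟦ CA.fromM x ⟧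
  fromM-natural (false , s) = pos[⟦⟧S+S1S] s
  fromM-natural (true , s)  = B.¬-cong (pos[⟦⟧S+S1S] s) ⟫ B.sym (¬-homo _)

semifieldFunctor : ∀ {c ℓ} → Functor (PerfectMVCat c ℓ) (IdemSemifieldCat c ℓ)
semifieldFunctor = record
  { F₀ = SemifieldOf.idempotentSemifield
  ; F₁ = λ {PA} {PB} → SemifieldHomOf.semiringHom PA PB
  ; identity = λ {PA} → SemifieldOf.map-identity PA (λ _ → SemifieldOf.≈₂-refl PA)
  ; homomorphism = λ {PA} {PB} {PC} {f} {g} →
      SemifieldOf.map-∘ PC (SemifieldHomOf.⟦⟧₂ PA PB f) (SemifieldHomOf.⟦⟧₂ PB PC g)
  ; F-resp-≈ = λ {PA} {PB} f≈g → SemifieldOf.map-resp PB (λ p → f≈g (proj₁ p) , f≈g (proj₂ p))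
  }

module _ {c ℓ} (em : ExcludedMiddle (c ⊔ ℓ)) where

  perfectMVAlgebraFunctor : Functor (IdemSemifieldCat c ℓ) (PerfectMVCat c ℓ)
  perfectMVAlgebraFunctor = record
    { F₀ = λ F → PerfectMVAlgebraOf.perfectMVAlgebra F em
    ; F₁ = λ {F} {F'} → PerfectMVHomOf.mvHom F F' em
    ; identity = λ {F} _ → PerfectMVAlgebraOf.≈M-refl F em
    ; homomorphism = λ {_} {_} {F''} _ → PerfectMVAlgebraOf.≈M-refl F'' em
    ; F-resp-≈ = λ {_} {F'} f≈g x →
        PerfectMVAlgebraOf.same-flag F' em (IdempotentSemifield.+-congʳ F' (f≈g (proj₂ x)))
    }

  unitIso : NaturalIsomorphism (idF (IdemSemifieldCat c ℓ)) (semifieldFunctor ∘F perfectMVAlgebraFunctor)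
  unitIso = record
    { η = λ F → SemifieldUnit.toS-semiringHom F em
    ; η⁻¹ = λ F → SemifieldUnit.fromS-semiringHom F em
    ; isoˡ = λ F → SemifieldUnit.fromS-toS F em
    ; isoʳ = λ F → SemifieldUnit.toS-fromS F em
    ; commute = λ {F} {F'} → SemifieldUnitNatural.toS-natural F F' em
    }

  counitIso : NaturalIsomorphism (perfectMVAlgebraFunctor ∘F semifieldFunctor) (idF (PerfectMVCat c ℓ))
  counitIso = record
    { η = λ PA → Counit.fromM-mvHom PA em
    ; η⁻¹ = λ PA → Counit.toM-mvHom PA em
    ; isoˡ = λ PA → Counit.toM-fromM PA em
    ; isoʳ = λ PA → Counit.fromM-toM PA em
    ; commute = λ {PA} {PB} → CounitNatural.fromM-natural PA PB em
    }

mainTheorem1 : ∀ {c ℓ} → ExcludedMiddle (c ⊔ ℓ) →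
    Equivalence (IdemSemifieldCat c ℓ) (PerfectMVCat c ℓ)
mainTheorem1 em = record
  { F = perfectMVAlgebraFunctor em
  ; G = semifieldFunctor
  ; unit = unitIso em
  ; counit = counitIso em
  }
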